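{- Let $C\subseteq\mathbb{F}_q^n$ be a projective completely regular linear code with covering radius $\rho$, and for $0\le i\le\rho$ let $d_i$ denote the number of cosets of $C$ in $\mathbb{F}_q^n$ of weight $i$. Then $(d_0,d_1,\dots,d_\rho)$ is a log-concave sequence.
   Context: A coset of $C$ is a translate $x+C$, $x\in\mathbb{F}_q^n$; its weight is the minimum Hamming weight of its elements. The covering radius $\rho$ is the maximum weight of a coset. $C$ is completely regular if the weight distribution of each coset depends only on the weight of that coset. $C$ is projective if, for a generator matrix of $C$, no column is zero and no two columns are scalar multiples of each other. A sequence $(s_0,\dots,s_\rho)$ is log-concave if $s_i^2\ge s_{i-1}s_{i+1}$ for all $1\le i\le \rho-1$. -}

module Defs where

open import Level using (Level; _⊔_) renaming (suc to lsuc)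
open import Algebra.Bundles using (CommutativeRing)
open import Data.Nat using (ℕ; zero; suc; _≤_; _<_) renaming (_*_ to _*ℕ_)
open import Data.Fin using (Fin; zero; suc)
open import Data.Product using (Σ; ∃; _×_; _,_)
open import Data.Unit.Polymorphic using (⊤)
open import Relation.Nullary using (¬_)
open import Relation.Binary.PropositionalEquality using (_≡_; _≢_)

-- "P has exactly m elements, counted up to the equivalence _~_":
-- an enumeration f : Fin m → A of elements satisfying P, pairwise
-- non-equivalent, such that every element satisfying P is equivalent to one of them.
Count : ∀ {a r p} {A : Set a} (_~_ : A → A → Set r) (P : A → Set p) (m : ℕ) → Set (a ⊔ r ⊔ p)
Count {A = A} _~_ P m =
  Σ (Fin m → A) λ f →
    (∀ i → P (f i)) ×
    (∀ i j → f i ~ f j → i ≡ j) ×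
    (∀ x → P x → ∃ λ i → x ~ f i)

record Field (c ℓ : Level) : Set (lsuc (c ⊔ ℓ)) where
  field
    commRing : CommutativeRing c ℓ
  open CommutativeRing commRing public
  field
    0≉1     : ¬ (0# ≈ 1#)
    inverse : ∀ x → ¬ (x ≈ 0#) → ∃ λ y → x * y ≈ 1#

record FiniteField (c ℓ : Level) (q : ℕ) : Set (lsuc (c ⊔ ℓ)) where
  field
    field′ : Field c ℓ
  open Field field′ public
  field
    size : Count _≈_ (λ _ → ⊤ {ℓ = c}) q

module Code {c ℓ q} (F : FiniteField c ℓ q) where
  open FiniteField F using (Carrier; _≈_; _+_; _*_; -_; 0#)

  Word : ℕ → Set c
  Word n = Fin n → Carrier

  _≈w_ : ∀ {n} → Word n → Word n → Set ℓ
  x ≈w y = ∀ j → x j ≈ y j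

  _+w_ : ∀ {n} → Word n → Word n → Word n
  (x +w y) j = x j + y j

  -w_ : ∀ {n} → Word n → Word n
  (-w x) j = - (x j)

  sumF : ∀ k → (Fin k → Carrier) → Carrier
  sumF zero    f = 0#
  sumF (suc k) f = f zero + sumF k (λ i → f (suc i))

  HasWeight : ∀ {n} → Word n → ℕ → Set ℓ
  HasWeight {n} x w = Count {A = Fin n} _≡_ (λ j → ¬ (x j ≈ 0#)) w

  module _ {k n : ℕ} (G : Fin k → Fin n → Carrier) where
    InC : Word n → Set (c ⊔ ℓ)
    InC x = ∃ λ (u : Fin k → Carrier) → ∀ j → x j ≈ sumF k (λ i → u i * G i j)

    SameCoset : Word n → Word n → Set (c ⊔ ℓ)
    SameCoset x y = InC (x +w (-w y))

    CosetWeight : ℕ → Word n → Set (c ⊔ ℓ)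
    CosetWeight i x =
      (∃ λ cw → InC cw × HasWeight (x +w cw) i) ×
      (∀ cw w → InC cw → HasWeight (x +w cw) w → i ≤ w)

    CoveringRadius : ℕ → Set (c ⊔ ℓ)
    CoveringRadius ρ =
      (∃ λ x → CosetWeight ρ x) × (∀ x i → CosetWeight i x → i ≤ ρ)

    CosetWeightCount : Word n → ℕ → ℕ → Set (c ⊔ ℓ)
    CosetWeightCount x w m =
      Count {A = Word n} _≈w_ (λ y → SameCoset y x × HasWeight y w) m

    CompletelyRegular : Set (c ⊔ ℓ)
    CompletelyRegular =
      ∀ x y i → CosetWeight i x → CosetWeight i y →
        ∀ w m → CosetWeightCount x w m → CosetWeightCount y w m

    Projective : Set (c ⊔ ℓ)
    Projective =
      (∀ j → ¬ (∀ i → G i j ≈ 0#)) ×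
      (∀ j j′ → j ≢ j′ → ¬ (∃ λ a → ∀ i → G i j ≈ a * G i j′))

LogConcave : (ℕ → ℕ) → ℕ → Set
LogConcave s ρ = ∀ i → suc i < ρ → s i *ℕ s (suc (suc i)) ≤ s (suc i) *ℕ s (suc i)

{-# OPTIONS --safe #-}
-- Call two words adjacent when they differ in one coordinate; along an edge the coset weight cwt
-- changes by at most one. For a completely regular code the numbers c_i and b_i of neighbours of a
-- word of coset weight i whose coset weight is i − 1 resp. i + 1 depend only on i: counting the
-- weight-w words in the cosets of all neighbours of x in two ways yields, for w = i − 1 and w = i,
-- linear equations whose coefficients only involve the weight distribution of x + C. Double counting
-- the edges between coset weights i and i + 1 gives d_i b_i = d_{i+1} c_{i+1}, and comparing the
-- neighbourhoods of adjacent words gives b_{i+1} ≤ b_i and c_{i+1} ≤ c_{i+2}. Hence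
-- d_i d_{i+2} = d_{i+1}² (b_{i+1} c_{i+1}) / (b_i c_{i+2}) ≤ d_{i+1}².
module Submission where

open import Defs
open import Level using (Level; _⊔_)
open import Data.Nat as ℕ using (ℕ; zero; suc; _+_; _*_; _∸_; _^_; _≤_; _<_; z≤n; s≤s; s≤s⁻¹; pred; NonZero; >-nonZero)
open import Data.Nat.Properties
open import Data.Nat.Tactic.RingSolver using (solve-∀)
open import Data.Fin as Fin using (Fin; zero; suc; toℕ; fromℕ<; combine; remQuot)
import Data.Fin.Properties as Finₚ
open import Data.Fin.Permutation using (permutation)
open import Data.Vec.Functional using (Vector; _∷_; head; tail; updateAt)
open import Data.Vec.Functional.Properties using (updateAt-updates; updateAt-minimal)
open import Data.Vec.Functional.Relation.Binary.Pointwise using (Pointwise)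
open import Data.List using (tabulate)
import Data.List.Relation.Unary.All.Properties as All
open import Data.List.Extrema ≤-totalOrder using (argmin; argmin-all; f[argmin]≤f[xs]; f[argmin]≤f[⊤])
open import Data.Bool using (if_then_else_)
open import Data.Product using (∃; _×_; _,_; proj₁; proj₂; uncurry)
open import Data.Empty using (⊥-elim)
open import Function using (_∘_)
open import Relation.Nullary using (Dec; yes; no; does; ¬_; ¬?; _×-dec_)
open import Relation.Unary using (Decidable)
open import Relation.Binary using (Rel; Setoid; Symmetric; Transitive)
open import Relation.Nullary.Decidable using (map′)
open import Relation.Binary.PropositionalEquality using (_≡_; _≢_; refl; sym; trans; cong; cong₂; subst; subst₂; module ≡-Reasoning)
import Relation.Binary.Reasoning.Setoid
import Algebra.Properties.Semiring.Sum +-*-semiring as Sumℕ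
import Algebra.Properties.CommutativeSemigroup +-commutativeSemigroup as +ℕ
import Algebra.Properties.CommutativeSemigroup *-commutativeSemigroup as *ℕ

opaque
  ∑ : ∀ {N} → (Fin N → ℕ) → ℕ
  ∑ = Sumℕ.sum

opaque
  unfolding ∑

  ∑-cong : ∀ {N} {f g : Fin N → ℕ} → (∀ i → f i ≡ g i) → ∑ f ≡ ∑ g
  ∑-cong = Sumℕ.sum-cong-≋

  ∑-distrib-+ : ∀ {N} (f g : Fin N → ℕ) → ∑ (λ i → f i + g i) ≡ ∑ f + ∑ g
  ∑-distrib-+ = Sumℕ.∑-distrib-+

  ∑-comm : ∀ {M N} (f : Fin M → Fin N → ℕ) → ∑ (λ i → ∑ (λ j → f i j)) ≡ ∑ (λ j → ∑ (λ i → f i j))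
  ∑-comm = Sumℕ.∑-comm

  *-distribˡ-∑ : ∀ {N} c (f : Fin N → ℕ) → c * ∑ f ≡ ∑ (λ i → c * f i)
  *-distribˡ-∑ = Sumℕ.*-distribˡ-sum

  *-distribʳ-∑ : ∀ {N} c (f : Fin N → ℕ) → ∑ f * c ≡ ∑ (λ i → f i * c)
  *-distribʳ-∑ = Sumℕ.*-distribʳ-sum

  ∑-reindex : ∀ {N} (f : Fin N → ℕ) (π π⁻¹ : Fin N → Fin N) →
              (∀ t → π (π⁻¹ t) ≡ t) → (∀ t → π⁻¹ (π t) ≡ t) → ∑ f ≡ ∑ (f ∘ π)
  ∑-reindex f π π⁻¹ inverseʳ inverseˡ = Sumℕ.∑-permute f (permutation π π⁻¹ inverseʳ inverseˡ)

  ∑-const : ∀ N c → ∑ {N} (λ _ → c) ≡ N * c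
  ∑-const zero    c = refl
  ∑-const (suc N) c = cong (c +_) (∑-const N c)

  ∑-mono-≤ : ∀ {N} {f g : Fin N → ℕ} → (∀ i → f i ≤ g i) → ∑ f ≤ ∑ g
  ∑-mono-≤ {zero}  _  = z≤n
  ∑-mono-≤ {suc N} le = +-mono-≤ (le zero) (∑-mono-≤ (le ∘ suc))

  ≤-∑ : ∀ {N} (f : Fin N → ℕ) t → f t ≤ ∑ f
  ≤-∑ f zero    = m≤m+n _ _
  ≤-∑ f (suc t) = ≤-trans (≤-∑ (f ∘ suc) t) (m≤n+m _ _)

  ∑-except : ∀ {N} (g : Fin N → ℕ) t₀ c → (∀ t → t ≢ t₀ → g t ≡ c) → ∑ g + c ≡ g t₀ + N * c
  ∑-except {suc N} g zero c g≡c = begin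
    g zero + ∑ (g ∘ suc) + c ≡⟨ cong (λ s → g zero + s + c) (trans (∑-cong (λ t → g≡c (suc t) λ ())) (∑-const N c)) ⟩
    g zero + N * c + c       ≡⟨ +-assoc (g zero) (N * c) c ⟩
    g zero + (N * c + c)     ≡⟨ cong (g zero +_) (+-comm (N * c) c) ⟩
    g zero + (c + N * c)     ∎
    where open ≡-Reasoning
  ∑-except {suc N} g (suc t₀) c g≡c = begin
    g zero + ∑ (g ∘ suc) + c      ≡⟨ +-assoc (g zero) _ c ⟩
    g zero + (∑ (g ∘ suc) + c)    ≡⟨ cong₂ _+_ (g≡c zero λ ())
                                             (∑-except (g ∘ suc) t₀ c λ t t≢t₀ → g≡c (suc t) (t≢t₀ ∘ Finₚ.suc-injective)) ⟩
    c + (g (suc t₀) + N * c)      ≡⟨ +ℕ.x∙yz≈y∙xz c (g (suc t₀)) (N * c) ⟩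
    g (suc t₀) + (c + N * c)      ∎
    where open ≡-Reasoning

  ∑-update : ∀ {N} (f g : Fin N → ℕ) p → (∀ j → j ≢ p → f j ≡ g j) → ∑ f + g p ≡ ∑ g + f p
  ∑-update {suc N} f g zero f≡g = begin
    f zero + ∑ (f ∘ suc) + g zero ≡⟨ cong (λ s → f zero + s + g zero) (∑-cong λ j → f≡g (suc j) λ ()) ⟩
    f zero + ∑ (g ∘ suc) + g zero ≡⟨ +-comm (f zero + _) (g zero) ⟩
    g zero + (f zero + ∑ (g ∘ suc)) ≡⟨ cong (g zero +_) (+-comm (f zero) _) ⟩
    g zero + (∑ (g ∘ suc) + f zero) ≡⟨ +-assoc (g zero) _ _ ⟨
    g zero + ∑ (g ∘ suc) + f zero ∎
    where open ≡-Reasoning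
  ∑-update {suc N} f g (suc p) f≡g = begin
    f zero + ∑ (f ∘ suc) + g (suc p)   ≡⟨ +-assoc (f zero) _ _ ⟩
    f zero + (∑ (f ∘ suc) + g (suc p)) ≡⟨ cong₂ _+_ (f≡g zero λ ())
                                                  (∑-update (f ∘ suc) (g ∘ suc) p λ j j≢p → f≡g (suc j) (j≢p ∘ Finₚ.suc-injective)) ⟩
    g zero + (∑ (g ∘ suc) + f (suc p)) ≡⟨ +-assoc (g zero) _ _ ⟨
    g zero + ∑ (g ∘ suc) + f (suc p)   ∎
    where open ≡-Reasoning

  ∑-∘-01 : ∀ {N} (b : Fin N → ℕ) (h : ℕ → ℕ) → (∀ p → b p ≤ 1) → ∑ (h ∘ b) ≡ (N ∸ ∑ b) * h 0 + ∑ b * h 1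
  ∑-∘-01 {zero}  b h _   = refl
  ∑-∘-01 {suc N} b h b≤1 with b zero | b≤1 zero | ∑-∘-01 (b ∘ suc) h (b≤1 ∘ suc)
  ... | 0 | _ | ih = begin
    h 0 + ∑ (h ∘ b ∘ suc)                ≡⟨ cong (h 0 +_) ih ⟩
    h 0 + ((N ∸ ∑b′) * h 0 + ∑b′ * h 1)  ≡⟨ +-assoc (h 0) ((N ∸ ∑b′) * h 0) (∑b′ * h 1) ⟨
    (1 + (N ∸ ∑b′)) * h 0 + ∑b′ * h 1    ≡⟨ cong (λ m → m * h 0 + ∑b′ * h 1) (+-∸-assoc 1 ∑b′≤N) ⟨
    (suc N ∸ ∑b′) * h 0 + ∑b′ * h 1      ∎
    where
    open ≡-Reasoning
    ∑b′ : ℕ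
    ∑b′ = ∑ (b ∘ suc)
    ∑b′≤N : ∑b′ ≤ N
    ∑b′≤N = ≤-trans (∑-mono-≤ (b≤1 ∘ suc)) (≤-reflexive (trans (∑-const N 1) (*-identityʳ N)))
  ... | 1 | _ | ih = begin
    h 1 + ∑ (h ∘ b ∘ suc)                ≡⟨ cong (h 1 +_) ih ⟩
    h 1 + ((N ∸ ∑b′) * h 0 + ∑b′ * h 1)  ≡⟨ +ℕ.x∙yz≈y∙xz (h 1) ((N ∸ ∑b′) * h 0) (∑b′ * h 1) ⟩
    (N ∸ ∑b′) * h 0 + (h 1 + ∑b′ * h 1)  ∎
    where
    open ≡-Reasoning
    ∑b′ : ℕ
    ∑b′ = ∑ (b ∘ suc)
  ... | suc (suc _) | s≤s () | _

∑-zero : ∀ {N} {f : Fin N → ℕ} → (∀ i → f i ≡ 0) → ∑ f ≡ 0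
∑-zero {N} f≡0 = trans (∑-cong f≡0) (trans (∑-const N 0) (*-zeroʳ N))

∑-single : ∀ {N} (g : Fin N → ℕ) t₀ → (∀ t → t ≢ t₀ → g t ≡ 0) → ∑ g ≡ g t₀
∑-single {N} g t₀ g≡0 = begin
  ∑ g          ≡⟨ +-identityʳ (∑ g) ⟨
  ∑ g + 0      ≡⟨ ∑-except g t₀ 0 g≡0 ⟩
  g t₀ + N * 0 ≡⟨ cong (g t₀ +_) (*-zeroʳ N) ⟩
  g t₀ + 0     ≡⟨ +-identityʳ (g t₀) ⟩
  g t₀         ∎
  where open ≡-Reasoning

𝟙 : ∀ {p} {P : Set p} → Dec P → ℕ
𝟙 d = if does d then 1 else 0

module _ {p} {P : Set p} where

  𝟙-yes : (d : Dec P) → P → 𝟙 d ≡ 1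
  𝟙-yes (yes _) _  = refl
  𝟙-yes (no ¬p) p′ = ⊥-elim (¬p p′)

  𝟙-no : (d : Dec P) → ¬ P → 𝟙 d ≡ 0
  𝟙-no (yes p′) ¬p = ⊥-elim (¬p p′)
  𝟙-no (no _)   _  = refl

  𝟙≤1 : (d : Dec P) → 𝟙 d ≤ 1
  𝟙≤1 (yes _) = s≤s z≤n
  𝟙≤1 (no _)  = z≤n

  𝟙*-cong : (d : Dec P) {m m′ : ℕ} → (P → m ≡ m′) → 𝟙 d * m ≡ 𝟙 d * m′
  𝟙*-cong (yes p′) m≡m′ = cong (1 *_) (m≡m′ p′)
  𝟙*-cong (no _)   _    = refl

  𝟙*-zero : (d : Dec P) (m : ℕ) → (P → m ≡ 0) → 𝟙 d * m ≡ 0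
  𝟙*-zero (yes p′) m m≡0 = trans (*-identityˡ m) (m≡0 p′)
  𝟙*-zero (no _)   m _   = refl

𝟙-mono : ∀ {p q} {P : Set p} {Q : Set q} (d : Dec P) (e : Dec Q) → (P → Q) → 𝟙 d ≤ 𝟙 e
𝟙-mono (yes p′) e P⇒Q = ≤-reflexive (sym (𝟙-yes e (P⇒Q p′)))
𝟙-mono (no _)   e _   = z≤n

module _ {p q} {P : Set p} {Q : Set q} where

  𝟙-cong : (d : Dec P) (e : Dec Q) → (P → Q) → (Q → P) → 𝟙 d ≡ 𝟙 e
  𝟙-cong d e P⇒Q Q⇒P = ≤-antisym (𝟙-mono d e P⇒Q) (𝟙-mono e d Q⇒P)

  𝟙-× : (d : Dec P) (e : Dec Q) → 𝟙 (d ×-dec e) ≡ 𝟙 d * 𝟙 e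
  𝟙-× (yes _) (yes _) = refl
  𝟙-× (yes _) (no _)  = refl
  𝟙-× (no _)  _       = refl

∑-select : ∀ {N} a → a < N → (g : ℕ → ℕ) → ∑ {N} (λ V → 𝟙 (a ℕ.≟ toℕ V) * g (toℕ V)) ≡ g a
∑-select a a<N g = begin
  ∑ (λ V → 𝟙 (a ℕ.≟ toℕ V) * g (toℕ V))  ≡⟨ ∑-single _ V₀ off ⟩
  𝟙 (a ℕ.≟ toℕ V₀) * g (toℕ V₀)          ≡⟨ 𝟙*-cong (a ℕ.≟ toℕ V₀) (cong g) ⟨
  𝟙 (a ℕ.≟ toℕ V₀) * g a                 ≡⟨ cong (_* g a) (𝟙-yes (a ℕ.≟ toℕ V₀) (sym (Finₚ.toℕ-fromℕ< a<N))) ⟩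
  1 * g a                                ≡⟨ *-identityˡ (g a) ⟩
  g a                                    ∎
  where
  open ≡-Reasoning
  V₀ = fromℕ< a<N
  off : ∀ V → V ≢ V₀ → 𝟙 (a ℕ.≟ toℕ V) * g (toℕ V) ≡ 0
  off V V≢V₀ = cong (_* g (toℕ V)) (𝟙-no (a ℕ.≟ toℕ V) λ a≡V → V≢V₀ (Finₚ.toℕ-injective (trans (sym a≡V) (sym (Finₚ.toℕ-fromℕ< a<N)))))

-- For |a − b| ≤ 1 exactly one of the three brackets is 1.
𝟙-split-≤1 : ∀ a b → a ≤ suc b → b ≤ suc a → (h : ℕ → ℕ) →
             h a ≡ 𝟙 (suc a ℕ.≟ b) * h (pred b) + 𝟙 (a ℕ.≟ b) * h b + 𝟙 (a ℕ.≟ suc b) * h (suc b)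
𝟙-split-≤1 zero          zero          _ _ h = sym (trans (+-identityʳ _) (+-identityʳ _))
𝟙-split-≤1 zero          (suc zero)    _ _ h = sym (trans (+-identityʳ _) (trans (+-identityʳ _) (+-identityʳ _)))
𝟙-split-≤1 (suc zero)    zero          _ _ h = sym (+-identityʳ _)
𝟙-split-≤1 (suc a)       (suc zero)    (s≤s a≤) (s≤s b≤) h = 𝟙-split-≤1 a zero a≤ b≤ (h ∘ suc)
𝟙-split-≤1 (suc a)       (suc (suc b)) (s≤s a≤) (s≤s b≤) h = 𝟙-split-≤1 a (suc b) a≤ b≤ (h ∘ suc)
𝟙-split-≤1 zero          (suc (suc b)) _ (s≤s ())
𝟙-split-≤1 (suc (suc a)) zero          (s≤s ()) _

𝟙-partition-≤1 : ∀ a b → a ≤ suc b → b ≤ suc a → 𝟙 (suc a ℕ.≟ b) + 𝟙 (a ℕ.≟ b) + 𝟙 (a ℕ.≟ suc b) ≡ 1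
𝟙-partition-≤1 a b a≤ b≤ = sym (trans (𝟙-split-≤1 a b a≤ b≤ λ _ → 1)
  (cong₂ _+_ (cong₂ _+_ (*-identityʳ (𝟙 (suc a ℕ.≟ b))) (*-identityʳ (𝟙 (a ℕ.≟ b)))) (*-identityʳ (𝟙 (a ℕ.≟ suc b)))))

log-concave-step : ∀ Δ₀ Δ₁ Δ₂ U₀ U₁ L₁ L₂ → Δ₀ * U₀ ≡ Δ₁ * L₁ → Δ₁ * U₁ ≡ Δ₂ * L₂ →
                   U₁ ≤ U₀ → L₁ ≤ L₂ → .{{NonZero L₁}} → .{{NonZero L₂}} → Δ₀ * Δ₂ ≤ Δ₁ * Δ₁
log-concave-step Δ₀ Δ₁ Δ₂ U₀ U₁ L₁ L₂ e₀ e₁ U₁≤U₀ L₁≤L₂ = *-cancelʳ-≤ (Δ₀ * Δ₂) (Δ₁ * Δ₁) (L₁ * L₂) {{m*n≢0 L₁ L₂}} (begin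
  Δ₀ * Δ₂ * (L₁ * L₂)   ≡⟨ ab*cd≡bd*ac Δ₀ Δ₂ L₁ L₂ ⟩
  Δ₂ * L₂ * (Δ₀ * L₁)   ≡⟨ cong (_* (Δ₀ * L₁)) e₁ ⟨
  Δ₁ * U₁ * (Δ₀ * L₁)   ≤⟨ *-mono-≤ (*-monoʳ-≤ Δ₁ U₁≤U₀) (*-monoʳ-≤ Δ₀ L₁≤L₂) ⟩
  Δ₁ * U₀ * (Δ₀ * L₂)   ≡⟨ ab*cd≡cb*ad Δ₁ U₀ Δ₀ L₂ ⟩
  Δ₀ * U₀ * (Δ₁ * L₂)   ≡⟨ cong (_* (Δ₁ * L₂)) e₀ ⟩
  Δ₁ * L₁ * (Δ₁ * L₂)   ≡⟨ ab*ad≡aa*bd Δ₁ L₁ L₂ ⟩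
  Δ₁ * Δ₁ * (L₁ * L₂)   ∎)
  where
  open ≤-Reasoning
  ab*cd≡bd*ac : ∀ a b c d → a * b * (c * d) ≡ b * d * (a * c)
  ab*cd≡bd*ac = solve-∀
  ab*cd≡cb*ad : ∀ a b c d → a * b * (c * d) ≡ c * b * (a * d)
  ab*cd≡cb*ad = solve-∀
  ab*ad≡aa*bd : ∀ a b d → a * b * (a * d) ≡ a * a * (b * d)
  ab*ad≡aa*bd = solve-∀

module _ {a r p} {A : Set a} {_~_ : Rel A r} {P : A → Set p}
         (sym~ : Symmetric _~_) (trans~ : Transitive _~_) where

  Count-≤ : ∀ {m m′} → Count _~_ P m → Count _~_ P m′ → m ≤ m′
  Count-≤ (f , Pf , f-inj , _) (f′ , _ , _ , f′-onto) = Finₚ.injective⇒≤ {f = h} h-inj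
    where
    h : _ → _
    h i = proj₁ (f′-onto (f i) (Pf i))
    h-inj : ∀ {i j} → h i ≡ h j → i ≡ j
    h-inj {i} {j} hi≡hj = f-inj i j (trans~ (proj₂ (f′-onto (f i) (Pf i)))
      (subst (λ t → f′ t ~ f j) (sym hi≡hj) (sym~ (proj₂ (f′-onto (f j) (Pf j))))))

  Count-unique : ∀ {m m′} → Count _~_ P m → Count _~_ P m′ → m ≡ m′
  Count-unique c c′ = ≤-antisym (Count-≤ c c′) (Count-≤ c′ c)

opaque
  unfolding ∑

  Count-∑𝟙 : ∀ {p N} (P : Fin N → Set p) (P? : Decidable P) → Count _≡_ P (∑ (𝟙 ∘ P?))
  Count-∑𝟙 {N = zero} P P? = (λ ()) , (λ ()) , (λ ()) , (λ ())
  Count-∑𝟙 {N = suc N} P P? with Count-∑𝟙 (P ∘ suc) (P? ∘ suc) | P? zero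
  ... | f , Pf , f-inj , f-onto | yes P0 = g , Pg , g-inj , g-onto
    where
    g : Fin (suc (∑ (𝟙 ∘ P? ∘ suc))) → Fin (suc N)
    g zero    = zero
    g (suc i) = suc (f i)
    Pg : ∀ i → P (g i)
    Pg zero    = P0
    Pg (suc i) = Pf i
    g-inj : ∀ i j → g i ≡ g j → i ≡ j
    g-inj zero    zero    _ = refl
    g-inj (suc i) (suc j) e = cong suc (f-inj i j (Finₚ.suc-injective e))
    g-onto : ∀ x → P x → ∃ λ i → x ≡ g i
    g-onto zero    _  = zero , refl
    g-onto (suc x) Px = let (i , e) = f-onto x Px in suc i , cong suc e
  ... | f , Pf , f-inj , f-onto | no ¬P0 = g , Pf , g-inj , g-onto
    where
    g : Fin (∑ (𝟙 ∘ P? ∘ suc)) → Fin (suc N)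
    g = suc ∘ f
    g-inj : ∀ i j → g i ≡ g j → i ≡ j
    g-inj i j e = f-inj i j (Finₚ.suc-injective e)
    g-onto : ∀ x → P x → ∃ λ i → x ≡ g i
    g-onto zero    P0 = ⊥-elim (¬P0 P0)
    g-onto (suc x) Px = let (i , e) = f-onto x Px in i , cong suc e

record Enumeration {a r} (S : Setoid a r) : Set (a ⊔ r) where
  open Setoid S using (Carrier; _≈_) renaming (reflexive to ≈-reflexive; sym to ≈-sym; trans to ≈-trans)
  field
    card       : ℕ
    enum       : Fin card → Carrier
    index      : Carrier → Fin card
    enum-index : ∀ x → x ≈ enum (index x)
    index-enum : ∀ t → index (enum t) ≡ t
    index-cong : ∀ {x y} → x ≈ y → index x ≡ index y

  _≈?_ : ∀ x y → Dec (x ≈ y)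
  x ≈? y = map′ (λ i≡j → ≈-trans (enum-index x) (≈-trans (≈-reflexive (cong enum i≡j)) (≈-sym (enum-index y))))
                index-cong (index x Fin.≟ index y)

  ∑ₑ : (Carrier → ℕ) → ℕ
  ∑ₑ g = ∑ (g ∘ enum)

  Respects≈ : (Carrier → ℕ) → Set (a ⊔ r)
  Respects≈ g = ∀ {x y} → x ≈ y → g x ≡ g y

  ≤-∑ₑ : (g : Carrier → ℕ) → Respects≈ g → ∀ x → g x ≤ ∑ₑ g
  ≤-∑ₑ g resp x = ≤-trans (≤-reflexive (resp (enum-index x))) (≤-∑ (g ∘ enum) (index x))

  ∑ₑ-reindex : (g : Carrier → ℕ) → Respects≈ g → (h h⁻¹ : Carrier → Carrier) →
               (∀ {x y} → x ≈ y → h x ≈ h y) → (∀ {x y} → x ≈ y → h⁻¹ x ≈ h⁻¹ y) →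
               (∀ x → h (h⁻¹ x) ≈ x) → (∀ x → h⁻¹ (h x) ≈ x) → ∑ₑ g ≡ ∑ₑ (g ∘ h)
  ∑ₑ-reindex g resp h h⁻¹ h-cong h⁻¹-cong inverseʳ inverseˡ =
    trans (∑-reindex (g ∘ enum) π π⁻¹ (inverse h h⁻¹ h-cong inverseʳ) (inverse h⁻¹ h h⁻¹-cong inverseˡ))
          (∑-cong λ t → sym (resp (enum-index (h (enum t)))))
    where
    π π⁻¹ : Fin card → Fin card
    π   t = index (h (enum t))
    π⁻¹ t = index (h⁻¹ (enum t))
    inverse : ∀ f f⁻¹ → (∀ {x y} → x ≈ y → f x ≈ f y) → (∀ x → f (f⁻¹ x) ≈ x) →
              ∀ t → index (f (enum (index (f⁻¹ (enum t))))) ≡ t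
    inverse f f⁻¹ f-cong f∘f⁻¹ t =
      trans (index-cong (≈-trans (f-cong (≈-sym (enum-index (f⁻¹ (enum t))))) (f∘f⁻¹ (enum t)))) (index-enum t)

  Count-∑ₑ : ∀ {p} (P : Carrier → Set p) (P? : Decidable P) → (∀ {x y} → x ≈ y → P x → P y) →
             Count _≈_ P (∑ₑ (𝟙 ∘ P?))
  Count-∑ₑ P P? resp with Count-∑𝟙 (P ∘ enum) (P? ∘ enum)
  ... | f , Pf , f-inj , f-onto = enum ∘ f , Pf , g-inj , g-onto
    where
    g-inj : ∀ i j → enum (f i) ≈ enum (f j) → i ≡ j
    g-inj i j e = f-inj i j (trans (sym (index-enum (f i))) (trans (index-cong e) (index-enum (f j))))
    g-onto : ∀ x → P x → ∃ λ i → x ≈ enum (f i)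
    g-onto x Px = let (i , e) = f-onto (index x) (resp (enum-index x) Px) in i , subst (λ t → x ≈ enum t) e (enum-index x)

Count⇒Enumeration : ∀ {a r p m} (S : Setoid a r) {P : Setoid.Carrier S → Set p} →
                    (∀ x → P x) → Count (Setoid._≈_ S) P m → Enumeration S
Count⇒Enumeration {m = m} S P-all (f , _ , f-inj , f-onto) = record
  { card = m ; enum = f ; index = index ; enum-index = λ x → proj₂ (f-onto x (P-all x))
  ; index-enum = λ t → f-inj _ _ (≈-sym (proj₂ (f-onto (f t) (P-all (f t)))))
  ; index-cong = λ {x} {y} x≈y → f-inj _ _ (≈-trans (≈-sym (proj₂ (f-onto x (P-all x)))) (≈-trans x≈y (proj₂ (f-onto y (P-all y)))))
  }
  where
  open Setoid S using () renaming (sym to ≈-sym; trans to ≈-trans)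
  index : Setoid.Carrier S → Fin m
  index x = proj₁ (f-onto x (P-all x))

module _ {a r} {S : Setoid a r} (E : Enumeration S) where
  open Setoid S using (Carrier; _≈_)
  open Enumeration E
  open import Data.Vec.Functional.Relation.Binary.Equality.Setoid S using (≋-setoid)

  enumVec : ∀ m → Fin (card ^ m) → Vector Carrier m
  enumVec zero    _ ()
  enumVec (suc m) t = uncurry (λ i t′ → enum i ∷ enumVec m t′) (remQuot (card ^ m) t)

  indexVec : ∀ m → Vector Carrier m → Fin (card ^ m)
  indexVec zero    _ = zero
  indexVec (suc m) x = combine (index (head x)) (indexVec m (tail x))

  enumVec-combine : ∀ m i t → enumVec (suc m) (combine i t) ≡ enum i ∷ enumVec m t
  enumVec-combine m i t = cong (uncurry λ i t′ → enum i ∷ enumVec m t′) (Finₚ.remQuot-combine i t)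

  enumVec-indexVec : ∀ m x → Pointwise _≈_ x (enumVec m (indexVec m x))
  enumVec-indexVec zero    x ()
  enumVec-indexVec (suc m) x j rewrite enumVec-combine m (index (head x)) (indexVec m (tail x)) with j
  ... | zero   = enum-index (head x)
  ... | suc j′ = enumVec-indexVec m (tail x) j′

  indexVec-enumVec : ∀ m t → indexVec m (enumVec m t) ≡ t
  indexVec-enumVec zero    zero = refl
  indexVec-enumVec (suc m) t = trans (on-parts (remQuot (card ^ m) t)) (Finₚ.combine-remQuot {card} (card ^ m) t)
    where
    on-parts : ∀ it → indexVec (suc m) (uncurry (λ i t′ → enum i ∷ enumVec m t′) it) ≡ uncurry combine it
    on-parts (i , t′) = cong₂ combine (index-enum i) (indexVec-enumVec m t′)

  indexVec-cong : ∀ m {x y} → Pointwise _≈_ x y → indexVec m x ≡ indexVec m y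
  indexVec-cong zero    _   = refl
  indexVec-cong (suc m) x≋y = cong₂ combine (index-cong (x≋y zero)) (indexVec-cong m (x≋y ∘ suc))

  vecEnumeration : ∀ m → Enumeration (≋-setoid m)
  vecEnumeration m = record
    { card = card ^ m ; enum = enumVec m ; index = indexVec m ; enum-index = enumVec-indexVec m
    ; index-enum = indexVec-enumVec m ; index-cong = indexVec-cong m }

module _ {c ℓ q} (F : FiniteField c ℓ q) where
  module K = FiniteField F
  open K using (Carrier; _≈_; 0#; setoid; size)
    renaming (_+_ to _+F_; _*_ to _*F_; -_ to -F_; refl to ≈-refl; sym to ≈-sym; trans to ≈-trans; reflexive to ≈-reflexive)
  open Code F
  open import Data.Vec.Functional.Relation.Binary.Equality.Setoid setoid using (≋-setoid; ≋-refl; ≋-sym; ≋-trans)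
  open import Algebra.Properties.Ring K.ring using (-‿distribˡ-*)
  open import Algebra.Properties.AbelianGroup K.+-abelianGroup using (⁻¹-∙-comm; ⁻¹-anti-homo‿-)
  open import Algebra.Properties.Group K.+-group using (⁻¹-involutive; inverseʳ-unique; //-rightDividesˡ; //-rightDividesʳ)
  open import Algebra.Properties.CommutativeSemigroup K.+-commutativeSemigroup using (interchange; xy∙z≈xz∙y)
  module ≈-Reasoning = Relation.Binary.Reasoning.Setoid setoid

  fieldEnum : Enumeration setoid
  fieldEnum = Count⇒Enumeration setoid (λ _ → _) size

  wordEnum : ∀ m → Enumeration (≋-setoid m)
  wordEnum = vecEnumeration fieldEnum

  module 𝔽 = Enumeration fieldEnum
  open 𝔽 using (_≈?_)

  x+a-[y+a]≈x-y : ∀ x y a → (x +F a) +F -F (y +F a) ≈ x +F -F y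
  x+a-[y+a]≈x-y x y a = begin
    (x +F a) +F -F (y +F a)     ≈⟨ K.+-congˡ (⁻¹-∙-comm y a) ⟨
    (x +F a) +F (-F y +F -F a)  ≈⟨ interchange x a (-F y) (-F a) ⟩
    (x +F -F y) +F (a +F -F a)  ≈⟨ K.+-congˡ (K.-‿inverseʳ a) ⟩
    (x +F -F y) +F 0#           ≈⟨ K.+-identityʳ _ ⟩
    x +F -F y                   ∎
    where open ≈-Reasoning

  x-y+[y-z]≈x-z : ∀ x y z → (x +F -F y) +F (y +F -F z) ≈ x +F -F z
  x-y+[y-z]≈x-z x y z = begin
    (x +F -F y) +F (y +F -F z)  ≈⟨ K.+-assoc x (-F y) _ ⟩
    x +F (-F y +F (y +F -F z))  ≈⟨ K.+-congˡ (K.+-assoc (-F y) y (-F z)) ⟨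
    x +F ((-F y +F y) +F -F z)  ≈⟨ K.+-congˡ (K.+-congʳ (K.-‿inverseˡ y)) ⟩
    x +F (0# +F -F z)           ≈⟨ K.+-congˡ (K.+-identityˡ _) ⟩
    x +F -F z                   ∎
    where open ≈-Reasoning

  sumF-cong : ∀ m {f g : Fin m → Carrier} → (∀ i → f i ≈ g i) → sumF m f ≈ sumF m g
  sumF-cong zero    _   = ≈-refl
  sumF-cong (suc m) f≈g = K.+-cong (f≈g zero) (sumF-cong m (f≈g ∘ suc))

  sumF-distrib-+ : ∀ m (f g : Fin m → Carrier) → sumF m (λ i → f i +F g i) ≈ sumF m f +F sumF m g
  sumF-distrib-+ zero    f g = ≈-sym (K.+-identityʳ 0#)
  sumF-distrib-+ (suc m) f g = ≈-trans (K.+-congˡ (sumF-distrib-+ m (f ∘ suc) (g ∘ suc))) (interchange _ _ _ _)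

  sumF-neg : ∀ m (f : Fin m → Carrier) → sumF m (λ i → -F f i) ≈ -F sumF m f
  sumF-neg zero    f = ≈-trans (≈-sym (K.-‿inverseʳ 0#)) (K.+-identityˡ (-F 0#))
  sumF-neg (suc m) f = ≈-trans (K.+-congˡ (sumF-neg m (f ∘ suc))) (⁻¹-∙-comm _ _)

  sumF-zero : ∀ m → sumF m (λ _ → 0#) ≈ 0#
  sumF-zero zero    = ≈-refl
  sumF-zero (suc m) = ≈-trans (K.+-congˡ (sumF-zero m)) (K.+-identityʳ 0#)

  0w : ∀ {m} → Word m
  0w _ = 0#

  wt₁ : Carrier → ℕ
  wt₁ a = 𝟙 (¬? (a ≈? 0#))

  wt : ∀ {m} → Word m → ℕ
  wt x = ∑ (wt₁ ∘ x)

  wt₁-cong : ∀ {a b} → a ≈ b → wt₁ a ≡ wt₁ b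
  wt₁-cong a≈b = 𝟙-cong (¬? (_ ≈? 0#)) (¬? (_ ≈? 0#)) (λ a≉0 b≈0 → a≉0 (≈-trans a≈b b≈0)) (λ b≉0 a≈0 → b≉0 (≈-trans (≈-sym a≈b) a≈0))

  wt-cong : ∀ {m} {x y : Word m} → x ≈w y → wt x ≡ wt y
  wt-cong x≈y = ∑-cong (λ j → wt₁-cong (x≈y j))

  wt≤length : ∀ {m} (x : Word m) → wt x ≤ m
  wt≤length {m} x = ≤-trans (∑-mono-≤ (λ j → 𝟙≤1 (¬? (x j ≈? 0#)))) (≤-reflexive (trans (∑-const m 1) (*-identityʳ m)))

  HasWeight-wt : ∀ {m} (x : Word m) → HasWeight x (wt x)
  HasWeight-wt x = Count-∑𝟙 (λ j → ¬ x j ≈ 0#) (λ j → ¬? (x j ≈? 0#))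

  HasWeight⇒≡wt : ∀ {m} {x : Word m} {w} → HasWeight x w → w ≡ wt x
  HasWeight⇒≡wt {x = x} hw = Count-unique sym trans hw (HasWeight-wt x)

  HasWeight? : ∀ {m} (x : Word m) w → Dec (HasWeight x w)
  HasWeight? x w = map′ (λ wt≡w → subst (HasWeight x) wt≡w (HasWeight-wt x)) (sym ∘ HasWeight⇒≡wt) (wt x ℕ.≟ w)

  addAt : ∀ {m} → Word m → Fin m → Carrier → Word m
  addAt x p a = updateAt x p (_+F a)

  addAt-at : ∀ {m} (x : Word m) p a → addAt x p a p ≡ x p +F a
  addAt-at x p a = updateAt-updates p x

  addAt-off : ∀ {m} (x : Word m) p a j → p ≢ j → addAt x p a j ≡ x j
  addAt-off x p a j p≢j = updateAt-minimal j p x (p≢j ∘ sym)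

  addAt-elim₂ : ∀ {m r} (R : Fin m → Carrier → Carrier → Set r) (x y : Word m) p a b →
                R p (x p +F a) (y p +F b) → (∀ j → p ≢ j → R j (x j) (y j)) →
                ∀ j → R j (addAt x p a j) (addAt y p b j)
  addAt-elim₂ R x y p a b at off j with p Fin.≟ j
  ... | yes refl = subst₂ (R p) (sym (addAt-at x p a)) (sym (addAt-at y p b)) at
  ... | no p≢j   = subst₂ (R j) (sym (addAt-off x p a j p≢j)) (sym (addAt-off y p b j p≢j)) (off j p≢j)

  addAt-cong : ∀ {m} {x y : Word m} p {a b} → x ≈w y → a ≈ b → addAt x p a ≈w addAt y p b
  addAt-cong {x = x} {y} p {a} {b} x≈y a≈b = addAt-elim₂ (λ _ → _≈_) x y p a b (K.+-cong (x≈y p) a≈b) (λ j _ → x≈y j)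

  addAt-inverse : ∀ {m} (x : Word m) p a → addAt (addAt x p a) p (-F a) ≈w x
  addAt-inverse x p a j with p Fin.≟ j
  ... | yes refl = ≈-trans (≈-reflexive (trans (addAt-at (addAt x p a) p (-F a)) (cong (_+F -F a) (addAt-at x p a))))
                           (//-rightDividesʳ a (x p))
  ... | no p≢j   = ≈-reflexive (trans (addAt-off (addAt x p a) p (-F a) j p≢j) (addAt-off x p a j p≢j))

  addAt-inverse′ : ∀ {m} (x : Word m) p a → addAt (addAt x p (-F a)) p a ≈w x
  addAt-inverse′ x p a =
    ≋-trans (addAt-cong p ≋-refl (≈-sym (⁻¹-involutive a))) (addAt-inverse x p (-F a))

  addAt-+w : ∀ {m} (x c : Word m) p a → (addAt x p a +w c) ≈w addAt (x +w c) p a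
  addAt-+w x c p a = addAt-elim₂ (λ j u v → u +F c j ≈ v) x (x +w c) p a a (xy∙z≈xz∙y (x p) a (c p)) (λ _ _ → ≈-refl)

  addAt-diff : ∀ {m} (x y : Word m) p a → (addAt x p a +w (-w addAt y p a)) ≈w (x +w (-w y))
  addAt-diff x y p a = addAt-elim₂ (λ j u v → u +F -F v ≈ x j +F -F y j) x y p a a (x+a-[y+a]≈x-y (x p) (y p) a) (λ _ _ → ≈-refl)

  Adj : ∀ {m} → Word m → Word m → Set ℓ
  Adj x y = ∃ λ p → ∀ j → p ≢ j → x j ≈ y j

  Adj-sym : ∀ {m} {x y : Word m} → Adj x y → Adj y x
  Adj-sym (p , x≈y) = p , λ j p≢j → ≈-sym (x≈y j p≢j)

  Adj-addAt : ∀ {m} (x : Word m) p a → Adj (addAt x p a) x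
  Adj-addAt x p a = p , λ j p≢j → ≈-reflexive (addAt-off x p a j p≢j)

  Adj-addAt₂ : ∀ {m} {x y : Word m} p a → Adj x y → Adj (addAt x p a) (addAt y p a)
  Adj-addAt₂ {x = x} {y} p a (p₀ , x≈y) =
    p₀ , λ j → addAt-elim₂ (λ j u v → p₀ ≢ j → u ≈ v) x y p a a (λ p₀≢p → K.+-congʳ (x≈y p p₀≢p)) (λ j _ → x≈y j) j

  Adj-+w : ∀ {m} {x y : Word m} c → Adj x y → Adj (x +w c) (y +w c)
  Adj-+w c (p , x≈y) = p , λ j p≢j → K.+-congʳ (x≈y j p≢j)

  wt-update : ∀ {m} {x y : Word m} p → (∀ j → p ≢ j → x j ≈ y j) → wt x + wt₁ (y p) ≡ wt y + wt₁ (x p)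
  wt-update {x = x} {y} p x≈y = ∑-update (wt₁ ∘ x) (wt₁ ∘ y) p λ j j≢p → wt₁-cong (x≈y j (j≢p ∘ sym))

  wt-addAt : ∀ {m} (x : Word m) p a → wt (addAt x p a) + wt₁ (x p) ≡ wt x + wt₁ (x p +F a)
  wt-addAt x p a = trans (wt-update p λ j p≢j → ≈-reflexive (addAt-off x p a j p≢j)) (cong (λ b → wt x + wt₁ b) (addAt-at x p a))

  wt-Adj : ∀ {m} {x y : Word m} → Adj x y → wt x ≤ suc (wt y)
  wt-Adj {x = x} {y} (p , x≈y) = begin
    wt x                ≤⟨ m≤m+n (wt x) (wt₁ (y p)) ⟩
    wt x + wt₁ (y p)    ≡⟨ wt-update p x≈y ⟩
    wt y + wt₁ (x p)    ≤⟨ +-monoʳ-≤ (wt y) (𝟙≤1 (¬? (x p ≈? 0#))) ⟩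
    wt y + 1            ≡⟨ +-comm (wt y) 1 ⟩
    suc (wt y)          ∎
    where open ≤-Reasoning

  ∑-negate : (f : Carrier → ℕ) → 𝔽.Respects≈ f → ∑ (λ t → f (-F 𝔽.enum t)) ≡ ∑ (f ∘ 𝔽.enum)
  ∑-negate f f-resp = sym (𝔽.∑ₑ-reindex f f-resp -F_ -F_ K.-‿cong K.-‿cong ⁻¹-involutive ⁻¹-involutive)

  module _ {m : ℕ} where
    private module 𝕎ₘ = Enumeration (wordEnum m)

    -- Neighbours of x are indexed by (p , a) ∈ Fin m × 𝔽_q, a = 0 included, so each word is its own
    -- neighbour m times.
    ∑ₙ : Word m → (Word m → ℕ) → ℕ
    ∑ₙ x g = ∑ λ p → ∑ λ t → g (addAt x p (𝔽.enum t))

    ∑ₙ-cong : ∀ x (g g′ : Word m → ℕ) → (∀ p t → g (addAt x p (𝔽.enum t)) ≡ g′ (addAt x p (𝔽.enum t))) → ∑ₙ x g ≡ ∑ₙ x g′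
    ∑ₙ-cong x g g′ g≡g′ = ∑-cong λ p → ∑-cong λ t → g≡g′ p t

    ∑ₙ-mono-≤ : ∀ x x′ (g g′ : Word m → ℕ) → (∀ p t → g (addAt x p (𝔽.enum t)) ≤ g′ (addAt x′ p (𝔽.enum t))) → ∑ₙ x g ≤ ∑ₙ x′ g′
    ∑ₙ-mono-≤ x x′ g g′ g≤g′ = ∑-mono-≤ λ p → ∑-mono-≤ λ t → g≤g′ p t

    ∑ₙ-distrib-+ : ∀ x (f g : Word m → ℕ) → ∑ₙ x (λ z → f z + g z) ≡ ∑ₙ x f + ∑ₙ x g
    ∑ₙ-distrib-+ x f g = trans (∑-cong λ p → ∑-distrib-+ _ _) (∑-distrib-+ _ _)

    *-distribˡ-∑ₙ : ∀ x c (g : Word m → ℕ) → c * ∑ₙ x g ≡ ∑ₙ x (λ z → c * g z)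
    *-distribˡ-∑ₙ x c g = trans (*-distribˡ-∑ c _) (∑-cong λ p → *-distribˡ-∑ c _)

    *-distribʳ-∑ₙ : ∀ x c (g : Word m → ℕ) → ∑ₙ x g * c ≡ ∑ₙ x (λ z → g z * c)
    *-distribʳ-∑ₙ x c g = trans (*-distribʳ-∑ c _) (∑-cong λ p → *-distribʳ-∑ c _)

    ≤-∑ₙ : ∀ x (g : Word m → ℕ) p t → g (addAt x p (𝔽.enum t)) ≤ ∑ₙ x g
    ≤-∑ₙ x g p t = ≤-trans (≤-∑ _ t) (≤-∑ (λ p → ∑ λ t → g (addAt x p (𝔽.enum t))) p)

    ∑ₙ-1 : ∀ x → ∑ₙ x (λ _ → 1) ≡ m * q
    ∑ₙ-1 x = trans (∑-cong λ p → trans (∑-const q 1) (*-identityʳ q)) (∑-const m q)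

    ∑ₑ-∑ₙ-comm : (g : Word m → Word m → ℕ) →
                 𝕎ₘ.∑ₑ (λ y → ∑ₙ y (g y)) ≡ ∑ λ p → ∑ λ t → 𝕎ₘ.∑ₑ λ y → g y (addAt y p (𝔽.enum t))
    ∑ₑ-∑ₙ-comm g = trans (∑-comm λ s p → ∑ λ t → h s p t) (∑-cong λ p → ∑-comm λ s t → h s p t)
      where
      h : Fin 𝕎ₘ.card → Fin m → Fin q → ℕ
      h s p t = g (𝕎ₘ.enum s) (addAt (𝕎ₘ.enum s) p (𝔽.enum t))

    ∑ₑ-addAt : (f : Word m → ℕ) → 𝕎ₘ.Respects≈ f → ∀ p a → 𝕎ₘ.∑ₑ (λ y → f (addAt y p a)) ≡ 𝕎ₘ.∑ₑ f
    ∑ₑ-addAt f f-resp p a = sym (𝕎ₘ.∑ₑ-reindex f f-resp (λ y → addAt y p a) (λ y → addAt y p (-F a))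
      (λ y≈ → addAt-cong p y≈ ≈-refl) (λ y≈ → addAt-cong p y≈ ≈-refl) (λ y → addAt-inverse′ y p a) (λ y → addAt-inverse y p a))

    -- z = addAt y p a  iff  y = addAt z p (−a), and a ↦ −a permutes 𝔽_q.
    ∑ₑ-∑ₙ-flip : (T : Word m → Word m → ℕ) → (∀ {y y′ z z′} → y ≈w y′ → z ≈w z′ → T y z ≡ T y′ z′) →
                 𝕎ₘ.∑ₑ (λ y → ∑ₙ y (T y)) ≡ 𝕎ₘ.∑ₑ (λ y → ∑ₙ y (λ z → T z y))
    ∑ₑ-∑ₙ-flip T T-resp = begin
      𝕎ₘ.∑ₑ (λ y → ∑ₙ y (T y))                               ≡⟨ ∑ₑ-∑ₙ-comm T ⟩
      ∑ (λ p → ∑ λ t → 𝕎ₘ.∑ₑ λ y → T y (addAt y p (𝔽.enum t)))       ≡⟨ ∑-cong (λ p → ∑-cong λ t → translate p (𝔽.enum t)) ⟩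
      ∑ (λ p → ∑ λ t → 𝕎ₘ.∑ₑ λ y → T (addAt y p (-F 𝔽.enum t)) y)   ≡⟨ ∑-cong (λ p → ∑-negate (λ a → 𝕎ₘ.∑ₑ λ y → T (addAt y p a) y)
                                                                        λ a≈b → ∑-cong λ s → T-resp (addAt-cong p ≋-refl a≈b) ≋-refl) ⟩
      ∑ (λ p → ∑ λ t → 𝕎ₘ.∑ₑ λ y → T (addAt y p (𝔽.enum t)) y)       ≡⟨ ∑ₑ-∑ₙ-comm (λ y z → T z y) ⟨
      𝕎ₘ.∑ₑ (λ y → ∑ₙ y (λ z → T z y))                      ∎
      where
      open ≡-Reasoning
      translate : ∀ p a → 𝕎ₘ.∑ₑ (λ y → T y (addAt y p a)) ≡ 𝕎ₘ.∑ₑ (λ y → T (addAt y p (-F a)) y)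
      translate p a = trans (∑-cong λ s → T-resp (≋-sym (addAt-inverse (𝕎ₘ.enum s) p a)) ≋-refl)
        (∑ₑ-addAt (λ y → T (addAt y p (-F a)) y) (λ y≈ → T-resp (addAt-cong p y≈ ≈-refl) y≈) p a)

  -- The number of a ∈ 𝔽_q with wt (addAt y p a) = w, where V = wt y and b = wt₁ (y p): exactly one a
  -- makes y p + a zero, the other q − 1 leave it nonzero.
  coordCount : ℕ → ℕ → ℕ → ℕ
  coordCount V w b = (𝟙 (V + 0 ℕ.≟ w + b) + q * 𝟙 (V + 1 ℕ.≟ w + b)) ∸ 𝟙 (V + 1 ℕ.≟ w + b)

  ∑-wt-addAt : ∀ {m} (y : Word m) p w → ∑ (λ t → 𝟙 (wt (addAt y p (𝔽.enum t)) ℕ.≟ w)) ≡ coordCount (wt y) w (wt₁ (y p))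
  ∑-wt-addAt y p w = trans (∑-cong by-coordinate) (trans (sym (m+n∸n≡m (∑ g) C)) (cong (_∸ C) except-t₀))
    where
    yₚ = y p
    V = wt y
    g : Fin q → ℕ
    g t = 𝟙 (V + wt₁ (yₚ +F 𝔽.enum t) ℕ.≟ w + wt₁ yₚ)
    C : ℕ
    C = 𝟙 (V + 1 ℕ.≟ w + wt₁ yₚ)
    by-coordinate : ∀ t → 𝟙 (wt (addAt y p (𝔽.enum t)) ℕ.≟ w) ≡ g t
    by-coordinate t = 𝟙-cong (_ ℕ.≟ w) (_ ℕ.≟ _)
      (λ wt≡w → trans (sym (wt-addAt y p (𝔽.enum t))) (cong (_+ wt₁ yₚ) wt≡w))
      (λ wt≡ → +-cancelʳ-≡ (wt₁ yₚ) _ _ (trans (wt-addAt y p (𝔽.enum t)) wt≡))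
    t₀ : Fin q
    t₀ = 𝔽.index (-F yₚ)
    yₚ+t₀≡0 : wt₁ (yₚ +F 𝔽.enum t₀) ≡ 0
    yₚ+t₀≡0 = 𝟙-no (¬? (_ ≈? 0#)) λ ≉0 → ≉0 (≈-trans (K.+-congˡ (≈-sym (𝔽.enum-index (-F yₚ)))) (K.-‿inverseʳ yₚ))
    yₚ+t≢0 : ∀ t → t ≢ t₀ → wt₁ (yₚ +F 𝔽.enum t) ≡ 1
    yₚ+t≢0 t t≢t₀ = 𝟙-yes (¬? (_ ≈? 0#)) λ ≈0 → t≢t₀ (trans (sym (𝔽.index-enum t)) (𝔽.index-cong (inverseʳ-unique yₚ (𝔽.enum t) ≈0)))
    except-t₀ : ∑ g + C ≡ 𝟙 (V + 0 ℕ.≟ w + wt₁ yₚ) + q * C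
    except-t₀ = trans (∑-except g t₀ C λ t t≢t₀ → cong (λ b → 𝟙 (V + b ℕ.≟ w + wt₁ yₚ)) (yₚ+t≢0 t t≢t₀))
                      (cong (λ b → 𝟙 (V + b ℕ.≟ w + wt₁ yₚ) + q * C) yₚ+t₀≡0)

  shellCount : ℕ → ℕ → ℕ → ℕ
  shellCount m V w = (m ∸ V) * coordCount V w 0 + V * coordCount V w 1

  ∑ₙ-wt : ∀ {m} w (y : Word m) → ∑ₙ y (λ z → 𝟙 (wt z ℕ.≟ w)) ≡ shellCount m (wt y) w
  ∑ₙ-wt w y = trans (∑-cong λ p → ∑-wt-addAt y p w) (∑-∘-01 (wt₁ ∘ y) (coordCount (wt y) w) λ p → 𝟙≤1 (¬? (y p ≈? 0#)))

  module _ {k n : ℕ} (G : Fin k → Fin n → Carrier) where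
    module 𝕄 = Enumeration (wordEnum k)
    module 𝕎 = Enumeration (wordEnum n)

    codeword : (Fin k → Carrier) → Word n
    codeword u j = sumF k (λ i → u i *F G i j)

    codeword-cong : ∀ {u v} → u ≈w v → codeword u ≈w codeword v
    codeword-cong u≈v j = sumF-cong k (λ i → K.*-cong (u≈v i) ≈-refl)

    InC-codeword : ∀ u → InC G (codeword u)
    InC-codeword u = u , λ _ → ≈-refl

    InC-0w : InC G 0w
    InC-0w = 0w , λ j → ≈-sym (≈-trans (sumF-cong k (λ i → K.zeroˡ (G i j))) (sumF-zero k))

    InC-+w : ∀ {x y} → InC G x → InC G y → InC G (x +w y)
    InC-+w (u , x≈uG) (v , y≈vG) = (u +w v) , λ j → ≈-trans (K.+-cong (x≈uG j) (y≈vG j))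
      (≈-sym (≈-trans (sumF-cong k (λ i → K.distribʳ (G i j) (u i) (v i))) (sumF-distrib-+ k _ _)))

    InC--w : ∀ {x} → InC G x → InC G (-w x)
    InC--w (u , x≈uG) = (-w u) , λ j → ≈-trans (K.-‿cong (x≈uG j))
      (≈-sym (≈-trans (sumF-cong k (λ i → ≈-sym (-‿distribˡ-* (u i) (G i j)))) (sumF-neg k _)))

    InC-resp : ∀ {x y} → x ≈w y → InC G x → InC G y
    InC-resp x≈y (u , x≈uG) = u , λ j → ≈-trans (≈-sym (x≈y j)) (x≈uG j)

    InC? : ∀ x → Dec (InC G x)
    InC? x = map′ (λ (t , x≈) → enum t , x≈) (λ (u , x≈uG) → index u , λ j → ≈-trans (x≈uG j) (codeword-cong (enum-index u) j))
                  (Finₚ.any? λ t → Finₚ.all? λ j → x j ≈? codeword (enum t) j)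
      where open 𝕄 using (enum; index; enum-index)

    SameCoset-refl : ∀ {x} → SameCoset G x x
    SameCoset-refl {x} = InC-resp (λ j → ≈-sym (K.-‿inverseʳ (x j))) InC-0w

    SameCoset-sym : ∀ {x y} → SameCoset G x y → SameCoset G y x
    SameCoset-sym {x} {y} = InC-resp (λ j → ⁻¹-anti-homo‿- (x j) (y j)) ∘ InC--w

    SameCoset-trans : ∀ {x y z} → SameCoset G x y → SameCoset G y z → SameCoset G x z
    SameCoset-trans {x} {y} {z} x~y y~z = InC-resp (λ j → x-y+[y-z]≈x-z (x j) (y j) (z j)) (InC-+w x~y y~z)

    SameCoset-resp : ∀ {x x′ y y′} → x ≈w x′ → y ≈w y′ → SameCoset G x y → SameCoset G x′ y′
    SameCoset-resp x≈x′ y≈y′ = InC-resp (λ j → K.+-cong (x≈x′ j) (K.-‿cong (y≈y′ j)))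

    SameCoset-+w : ∀ {x c} → InC G c → SameCoset G (x +w c) x
    SameCoset-+w {x} {c} = InC-resp λ j → ≈-sym (≈-trans (K.+-congʳ (K.+-comm (x j) (c j))) (//-rightDividesʳ (x j) (c j)))

    SameCoset? : ∀ x y → Dec (SameCoset G x y)
    SameCoset? x y = InC? (x +w (-w y))

    𝟙SameCoset-resp : ∀ x → 𝕎.Respects≈ (λ y → 𝟙 (SameCoset? y x))
    𝟙SameCoset-resp x y≈ = 𝟙-cong (SameCoset? _ x) (SameCoset? _ x) (SameCoset-resp y≈ ≋-refl) (SameCoset-resp (≋-sym y≈) ≋-refl)

    bestCodeword : Word n → Word n
    bestCodeword x = argmin (λ c → wt (x +w c)) 0w (tabulate (codeword ∘ 𝕄.enum))

    leader : Word n → Word n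
    leader x = x +w bestCodeword x

    cwt : Word n → ℕ
    cwt x = wt (leader x)

    InC-bestCodeword : ∀ x → InC G (bestCodeword x)
    InC-bestCodeword x = argmin-all (λ c → wt (x +w c)) {P = InC G} InC-0w (All.tabulate⁺ (InC-codeword ∘ 𝕄.enum))

    cwt-minimal : ∀ {x c} → InC G c → cwt x ≤ wt (x +w c)
    cwt-minimal {x} (u , c≈uG) =
      ≤-trans (All.tabulate⁻ (f[argmin]≤f[xs] {f = λ c → wt (x +w c)} 0w (tabulate (codeword ∘ enum))) (index u))
              (≤-reflexive (wt-cong λ j → K.+-congˡ (≈-sym (≈-trans (c≈uG j) (codeword-cong (enum-index u) j)))))
      where open 𝕄 using (enum; index; enum-index)

    cwt≤wt : ∀ x → cwt x ≤ wt x
    cwt≤wt x = ≤-trans (f[argmin]≤f[⊤] {f = λ c → wt (x +w c)} 0w (tabulate (codeword ∘ 𝕄.enum)))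
                       (≤-reflexive (wt-cong λ j → K.+-identityʳ (x j)))

    CosetWeight-cwt : ∀ x → CosetWeight G (cwt x) x
    CosetWeight-cwt x = (bestCodeword x , InC-bestCodeword x , HasWeight-wt _) ,
                        λ c w c∈C hw → subst (cwt x ≤_) (sym (HasWeight⇒≡wt hw)) (cwt-minimal c∈C)

    CosetWeight⇒≡cwt : ∀ {i x} → CosetWeight G i x → i ≡ cwt x
    CosetWeight⇒≡cwt {i} {x} ((c , c∈C , hw) , minimal) =
      ≤-antisym (minimal (bestCodeword x) (cwt x) (InC-bestCodeword x) (HasWeight-wt _))
                (subst (cwt x ≤_) (sym (HasWeight⇒≡wt hw)) (cwt-minimal c∈C))

    cwt-SameCoset-≤ : ∀ {x y} → SameCoset G x y → cwt y ≤ cwt x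
    cwt-SameCoset-≤ {x} {y} x~y = ≤-trans (cwt-minimal (InC-+w x~y (InC-bestCodeword x))) (≤-reflexive (wt-cong y+[x-y+c]≈x+c))
      where
      y+[x-y+c]≈x+c : (y +w ((x +w (-w y)) +w bestCodeword x)) ≈w (x +w bestCodeword x)
      y+[x-y+c]≈x+c j = ≈-trans (≈-sym (K.+-assoc (y j) _ _)) (≈-trans (K.+-congʳ (K.+-comm (y j) _)) (K.+-congʳ (//-rightDividesˡ (y j) (x j))))

    cwt-SameCoset : ∀ {x y} → SameCoset G x y → cwt x ≡ cwt y
    cwt-SameCoset x~y = ≤-antisym (cwt-SameCoset-≤ (SameCoset-sym x~y)) (cwt-SameCoset-≤ x~y)

    cwt-cong : ∀ {x y} → x ≈w y → cwt x ≡ cwt y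
    cwt-cong x≈y = cwt-SameCoset (SameCoset-resp ≋-refl x≈y SameCoset-refl)

    cwt-Adj : ∀ {x y} → Adj x y → cwt x ≤ suc (cwt y)
    cwt-Adj {x} {y} x~y = ≤-trans (cwt-minimal (InC-bestCodeword y)) (wt-Adj (Adj-+w (bestCodeword y) x~y))

    cwt-addAt-≤ : ∀ x p a → cwt (addAt x p a) ≤ suc (cwt x)
    cwt-addAt-≤ x p a = cwt-Adj (Adj-addAt x p a)

    cwt-addAt-≥ : ∀ x p a → cwt x ≤ suc (cwt (addAt x p a))
    cwt-addAt-≥ x p a = cwt-Adj (Adj-sym (Adj-addAt x p a))

    -- Clearing a nonzero coordinate of a coset leader lowers the coset weight by one.
    descend : ∀ {x j} → cwt x ≡ suc j → ∃ λ p → ∃ λ a → cwt (addAt x p a) ≡ j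
    descend {x} {j} cwt≡ with Finₚ.any? (λ p → ¬? (leader x p ≈? 0#))
    ... | no all-zero = ⊥-elim (0≢1+n (trans (sym (∑-zero λ p → 𝟙-no (¬? (_ ≈? 0#)) λ z≉0 → all-zero (p , z≉0))) cwt≡))
    ... | yes (p , zp≉0) = p , a , ≤-antisym cwt≤j (s≤s⁻¹ (subst (_≤ suc (cwt (addAt x p a))) cwt≡ (cwt-addAt-≥ x p a)))
      where
      z = leader x
      a = -F z p
      wt-cleared : wt (addAt z p a) + 1 ≡ suc j + 0
      wt-cleared = begin
        wt (addAt z p a) + 1               ≡⟨ cong (wt (addAt z p a) +_) (𝟙-yes (¬? (z p ≈? 0#)) zp≉0) ⟨
        wt (addAt z p a) + wt₁ (z p)       ≡⟨ wt-addAt z p a ⟩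
        wt z + wt₁ (z p +F a)              ≡⟨ cong₂ _+_ cwt≡ (𝟙-no (¬? (_ ≈? 0#)) λ ≉0 → ≉0 (K.-‿inverseʳ (z p))) ⟩
        suc j + 0                          ∎
        where open ≡-Reasoning
      cwt≤j : cwt (addAt x p a) ≤ j
      cwt≤j = ≤-trans (cwt-minimal (InC-bestCodeword x)) (≤-reflexive (trans (wt-cong (addAt-+w x (bestCodeword x) p a))
                (+-cancelʳ-≡ 1 _ _ (trans wt-cleared (trans (+-identityʳ (suc j)) (+-comm 1 j))))))

    cwt-exists : ∀ {j x} → j ≤ cwt x → ∃ λ y → cwt y ≡ j
    cwt-exists {j} {x} j≤cwt = go (cwt x ∸ j) x (sym (m+[n∸m]≡n j≤cwt))
      where
      go : ∀ d x → cwt x ≡ j + d → ∃ λ y → cwt y ≡ j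
      go zero    x cwt≡ = x , trans cwt≡ (+-identityʳ j)
      go (suc d) x cwt≡ = let (p , a , cwt≡′) = descend (trans cwt≡ (+-suc j d)) in go d (addAt x p a) cwt≡′

    SameCoset-addAt⁺ : ∀ {x y p a} → SameCoset G x y → SameCoset G (addAt x p a) (addAt y p a)
    SameCoset-addAt⁺ {x} {y} {p} {a} = InC-resp (≋-sym (addAt-diff x y p a))

    SameCoset-addAt⁻ : ∀ {x y p a} → SameCoset G (addAt x p a) (addAt y p a) → SameCoset G x y
    SameCoset-addAt⁻ {x} {y} {p} {a} = InC-resp (addAt-diff x y p a)

    lowerDeg levelDeg upperDeg : Word n → ℕ
    lowerDeg x = ∑ₙ x λ z → 𝟙 (suc (cwt z) ℕ.≟ cwt x)
    levelDeg x = ∑ₙ x λ z → 𝟙 (cwt z ℕ.≟ cwt x)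
    upperDeg x = ∑ₙ x λ z → 𝟙 (cwt z ℕ.≟ suc (cwt x))

    degrees-sum : ∀ x → lowerDeg x + levelDeg x + upperDeg x ≡ n * q
    degrees-sum x = begin
      lowerDeg x + levelDeg x + upperDeg x                      ≡⟨ cong (_+ upperDeg x) (∑ₙ-distrib-+ x lower level) ⟨
      ∑ₙ x (λ z → lower z + level z) + upperDeg x               ≡⟨ ∑ₙ-distrib-+ x (λ z → lower z + level z) upper ⟨
      ∑ₙ x (λ z → lower z + level z + upper z)                  ≡⟨ ∑ₙ-cong x (λ z → lower z + level z + upper z) (λ _ → 1) (λ p t →
                                                                     𝟙-partition-≤1 _ _ (cwt-addAt-≤ x p (𝔽.enum t)) (cwt-addAt-≥ x p (𝔽.enum t))) ⟩
      ∑ₙ x (λ _ → 1)                                            ≡⟨ ∑ₙ-1 x ⟩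
      n * q                                                     ∎
      where
      open ≡-Reasoning
      lower level upper : Word n → ℕ
      lower z = 𝟙 (suc (cwt z) ℕ.≟ cwt x)
      level z = 𝟙 (cwt z ℕ.≟ cwt x)
      upper z = 𝟙 (cwt z ℕ.≟ suc (cwt x))

    0<lowerDeg : ∀ x p a → suc (cwt (addAt x p a)) ≡ cwt x → 0 < lowerDeg x
    0<lowerDeg x p a down = ≤-trans (≤-reflexive (sym (𝟙-yes (suc (cwt z) ℕ.≟ cwt x) down′)))
                                    (≤-∑ₙ x (λ z → 𝟙 (suc (cwt z) ℕ.≟ cwt x)) p (𝔽.index a))
      where
      z = addAt x p (𝔽.enum (𝔽.index a))
      down′ : suc (cwt z) ≡ cwt x
      down′ = trans (cong suc (cwt-cong (addAt-cong p ≋-refl (≈-sym (𝔽.enum-index a))))) down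

    upperDeg-antitone : ∀ {x₀ x₁} → Adj x₀ x₁ → suc (cwt x₀) ≡ cwt x₁ → upperDeg x₁ ≤ upperDeg x₀
    upperDeg-antitone {x₀} {x₁} x₀~x₁ up = ∑ₙ-mono-≤ x₁ x₀ (upper x₁) (upper x₀) λ p t → 𝟙-mono (_ ℕ.≟ _) (_ ℕ.≟ _) λ up₁ →
      ≤-antisym (cwt-addAt-≤ x₀ p (𝔽.enum t))
                (s≤s⁻¹ (subst (_≤ suc (cwt (addAt x₀ p (𝔽.enum t)))) (trans up₁ (cong suc (sym up)))
                              (cwt-Adj (Adj-sym (Adj-addAt₂ p (𝔽.enum t) x₀~x₁)))))
      where
      upper : Word n → Word n → ℕ
      upper x z = 𝟙 (cwt z ℕ.≟ suc (cwt x))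

    lowerDeg-monotone : ∀ {x₀ x₁} → Adj x₀ x₁ → suc (cwt x₀) ≡ cwt x₁ → lowerDeg x₀ ≤ lowerDeg x₁
    lowerDeg-monotone {x₀} {x₁} x₀~x₁ up = ∑ₙ-mono-≤ x₀ x₁ (lower x₀) (lower x₁) λ p t → 𝟙-mono (_ ℕ.≟ _) (_ ℕ.≟ _) λ down₀ →
      trans (cong suc (≤-antisym
        (≤-trans (cwt-Adj (Adj-sym (Adj-addAt₂ p (𝔽.enum t) x₀~x₁))) (≤-reflexive down₀))
        (s≤s⁻¹ (subst (_≤ suc (cwt (addAt x₁ p (𝔽.enum t)))) (sym up) (cwt-addAt-≥ x₁ p (𝔽.enum t)))))) up
      where
      lower : Word n → Word n → ℕ
      lower x z = 𝟙 (suc (cwt z) ℕ.≟ cwt x)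

    ∑-upperDeg≡∑-lowerDeg : ∀ j → 𝕎.∑ₑ (λ y → 𝟙 (cwt y ℕ.≟ j) * upperDeg y) ≡ 𝕎.∑ₑ (λ y → 𝟙 (cwt y ℕ.≟ suc j) * lowerDeg y)
    ∑-upperDeg≡∑-lowerDeg j = begin
      𝕎.∑ₑ (λ y → 𝟙 (cwt y ℕ.≟ j) * upperDeg y)        ≡⟨ ∑-cong (λ s → from-upper (𝕎.enum s)) ⟩
      𝕎.∑ₑ (λ y → ∑ₙ y (T y))                          ≡⟨ ∑ₑ-∑ₙ-flip T T-resp ⟩
      𝕎.∑ₑ (λ y → ∑ₙ y (λ z → T z y))                  ≡⟨ ∑-cong (λ s → to-lower (𝕎.enum s)) ⟩
      𝕎.∑ₑ (λ y → 𝟙 (cwt y ℕ.≟ suc j) * lowerDeg y)    ∎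
      where
      open ≡-Reasoning
      T : Word n → Word n → ℕ
      T y z = 𝟙 (cwt y ℕ.≟ j) * 𝟙 (cwt z ℕ.≟ suc j)
      T-resp : ∀ {y y′ z z′} → y ≈w y′ → z ≈w z′ → T y z ≡ T y′ z′
      T-resp y≈ z≈ = cong₂ (λ u v → 𝟙 (u ℕ.≟ j) * 𝟙 (v ℕ.≟ suc j)) (cwt-cong y≈) (cwt-cong z≈)
      from-upper : ∀ y → 𝟙 (cwt y ℕ.≟ j) * upperDeg y ≡ ∑ₙ y (T y)
      from-upper y = trans (*-distribˡ-∑ₙ y (𝟙 (cwt y ℕ.≟ j)) (λ z → 𝟙 (cwt z ℕ.≟ suc (cwt y))))
        (∑ₙ-cong y (λ z → 𝟙 (cwt y ℕ.≟ j) * 𝟙 (cwt z ℕ.≟ suc (cwt y))) (T y) λ p t →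
          𝟙*-cong (cwt y ℕ.≟ j) (cong λ i → 𝟙 (cwt (addAt y p (𝔽.enum t)) ℕ.≟ suc i)))
      to-lower : ∀ y → ∑ₙ y (λ z → T z y) ≡ 𝟙 (cwt y ℕ.≟ suc j) * lowerDeg y
      to-lower y = trans (∑ₙ-cong y (λ z → T z y) (λ z → 𝟙 (cwt y ℕ.≟ suc j) * 𝟙 (suc (cwt z) ℕ.≟ cwt y)) λ p t →
                                   trans (*-comm (𝟙 (cwt (addAt y p (𝔽.enum t)) ℕ.≟ j)) _)
                                                  (sym (𝟙*-cong (cwt y ℕ.≟ suc j) (cong λ i → 𝟙 (suc (cwt (addAt y p (𝔽.enum t))) ℕ.≟ i)))))
                         (sym (*-distribˡ-∑ₙ y (𝟙 (cwt y ℕ.≟ suc j)) (λ z → 𝟙 (suc (cwt z) ℕ.≟ cwt y))))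

    cosetWeightCount : Word n → ℕ → ℕ
    cosetWeightCount x w = 𝕎.∑ₑ λ y → 𝟙 (SameCoset? y x) * 𝟙 (wt y ℕ.≟ w)

    CosetWeightCount-cosetWeightCount : ∀ x w → CosetWeightCount G x w (cosetWeightCount x w)
    CosetWeightCount-cosetWeightCount x w =
      subst (CosetWeightCount G x w) (∑-cong λ s → 𝟙-× (SameCoset? (𝕎.enum s) x) (HasWeight? (𝕎.enum s) w))
            (𝕎.Count-∑ₑ _ (λ y → SameCoset? y x ×-dec HasWeight? y w) resp)
      where
      resp : ∀ {y y′} → y ≈w y′ → SameCoset G y x × HasWeight y w → SameCoset G y′ x × HasWeight y′ w
      resp {y} {y′} y≈y′ (y~x , hw) = SameCoset-resp y≈y′ ≋-refl y~x ,
        subst (HasWeight y′) (sym (trans (HasWeight⇒≡wt hw) (wt-cong y≈y′))) (HasWeight-wt y′)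

    cosetWeightCount-below : ∀ {x w} → w < cwt x → cosetWeightCount x w ≡ 0
    cosetWeightCount-below {x} {w} w<cwt = ∑-zero λ s → 𝟙*-zero (SameCoset? (𝕎.enum s) x) _ λ y~x →
      𝟙-no (_ ℕ.≟ w) λ wt≡w → <⇒≱ w<cwt (subst (cwt x ≤_) wt≡w (subst (_≤ _) (cwt-SameCoset y~x) (cwt≤wt (𝕎.enum s))))

    0<cosetWeightCount : ∀ x → 0 < cosetWeightCount x (cwt x)
    0<cosetWeightCount x = ≤-trans (≤-reflexive (sym (cong₂ _*_ (𝟙-yes (SameCoset? (leader x) x) (SameCoset-+w (InC-bestCodeword x)))
                                                              (𝟙-yes (wt (leader x) ℕ.≟ cwt x) refl))))
                                   (𝕎.≤-∑ₑ _ (λ y≈ → cong₂ _*_ (𝟙SameCoset-resp x y≈) (cong (λ v → 𝟙 (v ℕ.≟ cwt x)) (wt-cong y≈))) (leader x))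

    ∑ₙ-cosetWeightCount : ∀ x w → ∑ₙ x (λ z → cosetWeightCount z w) ≡ 𝕎.∑ₑ (λ y → 𝟙 (SameCoset? y x) * shellCount n (wt y) w)
    ∑ₙ-cosetWeightCount x w = begin
      ∑ (λ p → ∑ λ t → 𝕎.∑ₑ λ y → 𝟙 (SameCoset? y (addAt x p (𝔽.enum t))) * 𝟙 (wt y ℕ.≟ w))
        ≡⟨ ∑-cong (λ p → ∑-cong λ t → translate p (𝔽.enum t)) ⟩
      ∑ (λ p → ∑ λ t → 𝕎.∑ₑ λ y → 𝟙 (SameCoset? y x) * 𝟙 (wt (addAt y p (𝔽.enum t)) ℕ.≟ w))
        ≡⟨ ∑ₑ-∑ₙ-comm (λ y z → 𝟙 (SameCoset? y x) * 𝟙 (wt z ℕ.≟ w)) ⟨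
      𝕎.∑ₑ (λ y → ∑ₙ y λ z → 𝟙 (SameCoset? y x) * 𝟙 (wt z ℕ.≟ w))
        ≡⟨ ∑-cong (λ s → trans (sym (*-distribˡ-∑ₙ (𝕎.enum s) (𝟙 (SameCoset? (𝕎.enum s) x)) (λ z → 𝟙 (wt z ℕ.≟ w))))
                               (cong (𝟙 (SameCoset? (𝕎.enum s) x) *_) (∑ₙ-wt w (𝕎.enum s)))) ⟩
      𝕎.∑ₑ (λ y → 𝟙 (SameCoset? y x) * shellCount n (wt y) w) ∎
      where
      open ≡-Reasoning
      translate : ∀ p a → 𝕎.∑ₑ (λ y → 𝟙 (SameCoset? y (addAt x p a)) * 𝟙 (wt y ℕ.≟ w))
                        ≡ 𝕎.∑ₑ (λ y → 𝟙 (SameCoset? y x) * 𝟙 (wt (addAt y p a) ℕ.≟ w))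
      translate p a = trans (sym (∑ₑ-addAt _ resp p a)) (∑-cong λ s → cong (_* 𝟙 (wt (addAt (𝕎.enum s) p a) ℕ.≟ w))
        (𝟙-cong (SameCoset? _ _) (SameCoset? _ _) SameCoset-addAt⁻ SameCoset-addAt⁺))
        where
        resp : 𝕎.Respects≈ (λ y → 𝟙 (SameCoset? y (addAt x p a)) * 𝟙 (wt y ℕ.≟ w))
        resp y≈ = cong₂ _*_ (𝟙SameCoset-resp (addAt x p a) y≈) (cong (λ v → 𝟙 (v ℕ.≟ w)) (wt-cong y≈))

    ∑-coset-by-weight : ∀ x (g : ℕ → ℕ) →
                        𝕎.∑ₑ (λ y → 𝟙 (SameCoset? y x) * g (wt y)) ≡ ∑ (λ (V : Fin (suc n)) → g (toℕ V) * cosetWeightCount x (toℕ V))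
    ∑-coset-by-weight x g = sym (begin
      ∑ (λ V → g (toℕ V) * 𝕎.∑ₑ (B V))                 ≡⟨ ∑-cong (λ V → *-distribˡ-∑ (g (toℕ V)) (B V ∘ 𝕎.enum)) ⟩
      ∑ (λ V → 𝕎.∑ₑ λ y → g (toℕ V) * B V y)          ≡⟨ ∑-comm (λ V s → g (toℕ V) * B V (𝕎.enum s)) ⟩
      𝕎.∑ₑ (λ y → ∑ λ V → g (toℕ V) * B V y)          ≡⟨ ∑-cong (λ s → at (𝕎.enum s)) ⟩
      𝕎.∑ₑ (λ y → 𝟙 (SameCoset? y x) * g (wt y))      ∎)
      where
      open ≡-Reasoning
      B : Fin (suc n) → Word n → ℕ
      B V y = 𝟙 (SameCoset? y x) * 𝟙 (wt y ℕ.≟ toℕ V)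
      at : ∀ y → ∑ (λ V → g (toℕ V) * B V y) ≡ 𝟙 (SameCoset? y x) * g (wt y)
      at y = begin
        ∑ (λ V → g (toℕ V) * (y~x * 𝟙 (wt y ℕ.≟ toℕ V)))  ≡⟨ ∑-cong (λ V → *ℕ.x∙yz≈y∙zx (g (toℕ V)) y~x (𝟙 (wt y ℕ.≟ toℕ V))) ⟩
        ∑ (λ V → y~x * (𝟙 (wt y ℕ.≟ toℕ V) * g (toℕ V)))  ≡⟨ *-distribˡ-∑ y~x (λ V → 𝟙 (wt y ℕ.≟ toℕ V) * g (toℕ V)) ⟨
        y~x * ∑ (λ V → 𝟙 (wt y ℕ.≟ toℕ V) * g (toℕ V))    ≡⟨ cong (y~x *_) (∑-select (wt y) (s≤s (wt≤length y)) g) ⟩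
        y~x * g (wt y)                                     ∎
        where
        y~x = 𝟙 (SameCoset? y x)

    codeSize : ℕ
    codeSize = 𝕎.∑ₑ (𝟙 ∘ InC?)

    0<codeSize : 0 < codeSize
    0<codeSize = ≤-trans (≤-reflexive (sym (𝟙-yes (InC? 0w) InC-0w)))
                         (𝕎.≤-∑ₑ _ (λ y≈ → 𝟙-cong (InC? _) (InC? _) (InC-resp y≈) (InC-resp (≋-sym y≈))) 0w)

    cosetSize : ∀ x → 𝕎.∑ₑ (λ y → 𝟙 (SameCoset? y x)) ≡ codeSize
    cosetSize x = trans (𝕎.∑ₑ-reindex _ (𝟙SameCoset-resp x) (_+w x) (λ y → y +w (-w x)) (λ y≈ j → K.+-congʳ (y≈ j)) (λ y≈ j → K.+-congʳ (y≈ j))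
                                       (λ y j → //-rightDividesˡ (x j) (y j)) (λ y j → //-rightDividesʳ (x j) (y j)))
                        (∑-cong λ s → 𝟙-cong (SameCoset? _ x) (InC? _) (InC-resp λ j → //-rightDividesʳ (x j) (𝕎.enum s j))
                                                                      (InC-resp λ j → ≈-sym (//-rightDividesʳ (x j) (𝕎.enum s j))))

    levelSize : ℕ → ℕ
    levelSize j = 𝕎.∑ₑ λ y → 𝟙 (cwt y ℕ.≟ j)

    levelSize-Count : ∀ {j m} → Count (SameCoset G) (CosetWeight G j) m → levelSize j ≡ m * codeSize
    levelSize-Count {j} {m} (r , r-weight , r-inj , r-onto) = begin
      𝕎.∑ₑ (λ y → 𝟙 (cwt y ℕ.≟ j))                  ≡⟨ ∑-cong (λ s → level≡∑cosets (𝕎.enum s)) ⟩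
      𝕎.∑ₑ (λ y → ∑ λ κ → 𝟙 (SameCoset? y (r κ)))   ≡⟨ ∑-comm (λ s κ → 𝟙 (SameCoset? (𝕎.enum s) (r κ))) ⟩
      ∑ (λ κ → 𝕎.∑ₑ λ y → 𝟙 (SameCoset? y (r κ)))   ≡⟨ ∑-cong (cosetSize ∘ r) ⟩
      ∑ {m} (λ _ → codeSize)                        ≡⟨ ∑-const m codeSize ⟩
      m * codeSize                                  ∎
      where
      open ≡-Reasoning
      level≡∑cosets : ∀ y → 𝟙 (cwt y ℕ.≟ j) ≡ ∑ λ κ → 𝟙 (SameCoset? y (r κ))
      level≡∑cosets y with cwt y ℕ.≟ j
      ... | no cwt≢j = trans (𝟙-no (cwt y ℕ.≟ j) cwt≢j) (sym (∑-zero λ κ → 𝟙-no (SameCoset? y (r κ)) λ y~r →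
                         cwt≢j (trans (cwt-SameCoset y~r) (sym (CosetWeight⇒≡cwt (r-weight κ))))))
      ... | yes cwt≡j with r-onto y (subst (λ i → CosetWeight G i y) cwt≡j (CosetWeight-cwt y))
      ...   | κ₀ , y~rκ₀ = trans (𝟙-yes (cwt y ℕ.≟ j) cwt≡j) (sym (trans (∑-single _ κ₀ λ κ κ≢κ₀ → 𝟙-no (SameCoset? y (r κ)) λ y~rκ →
                                       κ≢κ₀ (r-inj κ κ₀ (SameCoset-trans (SameCoset-sym y~rκ) y~rκ₀)))
                                    (𝟙-yes (SameCoset? y (r κ₀)) y~rκ₀)))

    ∑-level : ∀ j (f : Word n → ℕ) y₀ → (∀ y → cwt y ≡ j → f y ≡ f y₀) →
              𝕎.∑ₑ (λ y → 𝟙 (cwt y ℕ.≟ j) * f y) ≡ levelSize j * f y₀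
    ∑-level j f y₀ f-const = trans (∑-cong λ s → 𝟙*-cong (cwt (𝕎.enum s) ℕ.≟ j) (f-const (𝕎.enum s)))
                                   (sym (*-distribʳ-∑ (f y₀) λ s → 𝟙 (cwt (𝕎.enum s) ℕ.≟ j)))

    module _ (cr : CompletelyRegular G) where

      cosetWeightCount-CR : ∀ {x x′} → cwt x ≡ cwt x′ → ∀ w → cosetWeightCount x w ≡ cosetWeightCount x′ w
      cosetWeightCount-CR {x} {x′} cwt≡ w = Count-unique ≋-sym ≋-trans
        (cr x x′ (cwt x) (CosetWeight-cwt x) (subst (λ i → CosetWeight G i x′) (sym cwt≡) (CosetWeight-cwt x′))
            w _ (CosetWeightCount-cosetWeightCount x w))
        (CosetWeightCount-cosetWeightCount x′ w)

      -- The weight distribution shared by all cosets of weight j (0 if there are none).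
      levelCount : ℕ → ℕ → ℕ
      levelCount j w with Finₚ.any? (λ s → cwt (𝕎.enum s) ℕ.≟ j)
      ... | yes (s , _) = cosetWeightCount (𝕎.enum s) w
      ... | no _        = 0

      levelCount-spec : ∀ {x j} → cwt x ≡ j → ∀ w → cosetWeightCount x w ≡ levelCount j w
      levelCount-spec {x} {j} cwt≡j w with Finₚ.any? (λ s → cwt (𝕎.enum s) ℕ.≟ j)
      ... | yes (s , cwt≡j′) = cosetWeightCount-CR (trans cwt≡j (sym cwt≡j′)) w
      ... | no none          = ⊥-elim (none (𝕎.index x , trans (cwt-cong (≋-sym (𝕎.enum-index x))) cwt≡j))

      levelCount-below : ∀ {j w} → w < j → levelCount j w ≡ 0
      levelCount-below {j} {w} w<j with Finₚ.any? (λ s → cwt (𝕎.enum s) ℕ.≟ j)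
      ... | yes (s , cwt≡j) = cosetWeightCount-below (subst (w <_) (sym cwt≡j) w<j)
      ... | no _            = refl

      *-levelCount-below : ∀ m {j w} → w < j → m * levelCount j w ≡ 0
      *-levelCount-below m w<j = trans (cong (m *_) (levelCount-below w<j)) (*-zeroʳ m)

      0<levelCount : ∀ {x j} → cwt x ≡ j → 0 < levelCount j j
      0<levelCount {x} refl = subst (0 <_) (levelCount-spec refl (cwt x)) (0<cosetWeightCount x)

      ∑ₙ-cosetWeightCount-by-degree : ∀ x w → ∑ₙ x (λ z → cosetWeightCount z w) ≡
        lowerDeg x * levelCount (pred (cwt x)) w + levelDeg x * levelCount (cwt x) w + upperDeg x * levelCount (suc (cwt x)) w
      ∑ₙ-cosetWeightCount-by-degree x w = begin
        ∑ₙ x (λ z → cosetWeightCount z w)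
          ≡⟨ ∑ₙ-cong x (λ z → cosetWeightCount z w) (λ z → levelCount (cwt z) w) (λ p t → levelCount-spec refl w) ⟩
        ∑ₙ x (λ z → levelCount (cwt z) w)
          ≡⟨ ∑ₙ-cong x (λ z → levelCount (cwt z) w) (λ z → lower z * α₋ + level z * α₀ + upper z * α₊)
                     (λ p t → 𝟙-split-≤1 _ i (cwt-addAt-≤ x p (𝔽.enum t)) (cwt-addAt-≥ x p (𝔽.enum t)) λ j → levelCount j w) ⟩
        ∑ₙ x (λ z → lower z * α₋ + level z * α₀ + upper z * α₊)
          ≡⟨ ∑ₙ-distrib-+ x (λ z → lower z * α₋ + level z * α₀) (λ z → upper z * α₊) ⟩
        ∑ₙ x (λ z → lower z * α₋ + level z * α₀) + ∑ₙ x (λ z → upper z * α₊)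
          ≡⟨ cong (_+ ∑ₙ x (λ z → upper z * α₊)) (∑ₙ-distrib-+ x (λ z → lower z * α₋) (λ z → level z * α₀)) ⟩
        ∑ₙ x (λ z → lower z * α₋) + ∑ₙ x (λ z → level z * α₀) + ∑ₙ x (λ z → upper z * α₊)
          ≡⟨ cong₂ _+_ (cong₂ _+_ (*-distribʳ-∑ₙ x α₋ lower) (*-distribʳ-∑ₙ x α₀ level)) (*-distribʳ-∑ₙ x α₊ upper) ⟨
        lowerDeg x * α₋ + levelDeg x * α₀ + upperDeg x * α₊ ∎
        where
        open ≡-Reasoning
        i = cwt x
        α₋ = levelCount (pred i) w
        α₀ = levelCount i w
        α₊ = levelCount (suc i) w
        lower level upper : Word n → ℕ
        lower z = 𝟙 (suc (cwt z) ℕ.≟ i)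
        level z = 𝟙 (cwt z ℕ.≟ i)
        upper z = 𝟙 (cwt z ℕ.≟ suc i)

      neighbourProfile : ℕ → ℕ → ℕ
      neighbourProfile i w = ∑ λ (V : Fin (suc n)) → shellCount n (toℕ V) w * levelCount i (toℕ V)

      -- Count the pairs (z , y) with z a neighbour of x and y a weight-w word of z + C: grouped by z this is
      -- the left-hand side, grouped by y ∈ x + C it only depends on the weight distribution of x + C.
      degree-equation : ∀ {x i} → cwt x ≡ i → ∀ w →
        lowerDeg x * levelCount (pred i) w + levelDeg x * levelCount i w + upperDeg x * levelCount (suc i) w ≡ neighbourProfile i w
      degree-equation {x} refl w = begin
        lowerDeg x * levelCount (pred (cwt x)) w + levelDeg x * levelCount (cwt x) w + upperDeg x * levelCount (suc (cwt x)) w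
          ≡⟨ ∑ₙ-cosetWeightCount-by-degree x w ⟨
        ∑ₙ x (λ z → cosetWeightCount z w)                                   ≡⟨ ∑ₙ-cosetWeightCount x w ⟩
        𝕎.∑ₑ (λ y → 𝟙 (SameCoset? y x) * shellCount n (wt y) w)            ≡⟨ ∑-coset-by-weight x (λ V → shellCount n V w) ⟩
        ∑ (λ V → shellCount n (toℕ V) w * cosetWeightCount x (toℕ V))
          ≡⟨ ∑-cong (λ V → cong (shellCount n (toℕ V) w *_) (levelCount-spec refl (toℕ V))) ⟩
        neighbourProfile (cwt x) w                                          ∎
        where open ≡-Reasoning

      lowerDeg-CR : ∀ {x x′ i} → cwt x ≡ i → cwt x′ ≡ i → lowerDeg x ≡ lowerDeg x′
      lowerDeg-CR {x} {x′} {zero} cwt≡0 cwt′≡0 = trans (bottom x cwt≡0) (sym (bottom x′ cwt′≡0))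
        where
        bottom : ∀ y → cwt y ≡ 0 → lowerDeg y ≡ 0
        bottom y cwt≡0 = ∑-zero λ p → ∑-zero λ t → 𝟙-no (_ ℕ.≟ cwt y) λ suc≡cwt → 1+n≢0 (trans suc≡cwt cwt≡0)
      lowerDeg-CR {x} {x′} {suc j} cwt≡ cwt′≡ =
        *-cancelʳ-≡ _ _ (levelCount j j) {{>-nonZero (0<levelCount (proj₂ (proj₂ (descend cwt≡))))}}
                    (trans (equation x cwt≡) (sym (equation x′ cwt′≡)))
        where
        equation : ∀ y → cwt y ≡ suc j → lowerDeg y * levelCount j j ≡ neighbourProfile (suc j) j
        equation y cwt≡ = begin
          lowerDeg y * levelCount j j                     ≡⟨ +-identityʳ (lowerDeg y * levelCount j j) ⟨
          lowerDeg y * levelCount j j + 0                 ≡⟨ +-identityʳ (lowerDeg y * levelCount j j + 0) ⟨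
          lowerDeg y * levelCount j j + 0 + 0             ≡⟨ cong₂ (λ u v → lowerDeg y * levelCount j j + u + v)
                                                               (*-levelCount-below (levelDeg y) (n<1+n j))
                                                               (*-levelCount-below (upperDeg y) (<-trans (n<1+n j) (n<1+n (suc j)))) ⟨
          lowerDeg y * levelCount j j + levelDeg y * levelCount (suc j) j + upperDeg y * levelCount (suc (suc j)) j
                                                          ≡⟨ degree-equation cwt≡ j ⟩
          neighbourProfile (suc j) j                      ∎
          where open ≡-Reasoning

      levelDeg-CR : ∀ {x x′ i} → cwt x ≡ i → cwt x′ ≡ i → levelDeg x ≡ levelDeg x′
      levelDeg-CR {x} {x′} {i} cwt≡ cwt′≡ = *-cancelʳ-≡ _ _ (levelCount i i) {{>-nonZero (0<levelCount cwt≡)}}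
        (+-cancelˡ-≡ (lowerDeg x * levelCount (pred i) i) _ _
          (trans (equation x cwt≡) (trans (sym (equation x′ cwt′≡))
                 (cong (λ u → u * levelCount (pred i) i + _) (lowerDeg-CR cwt′≡ cwt≡)))))
        where
        equation : ∀ y → cwt y ≡ i → lowerDeg y * levelCount (pred i) i + levelDeg y * levelCount i i ≡ neighbourProfile i i
        equation y cwt≡ = begin
          L + S                                            ≡⟨ +-identityʳ (L + S) ⟨
          L + S + 0                                        ≡⟨ cong (L + S +_) (*-levelCount-below (upperDeg y) (n<1+n i)) ⟨
          L + S + upperDeg y * levelCount (suc i) i        ≡⟨ degree-equation cwt≡ i ⟩
          neighbourProfile i i                             ∎
          where
          open ≡-Reasoning
          L = lowerDeg y * levelCount (pred i) i
          S = levelDeg y * levelCount i i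

      upperDeg-CR : ∀ {x x′} → cwt x ≡ cwt x′ → upperDeg x ≡ upperDeg x′
      upperDeg-CR {x} {x′} cwt≡ = +-cancelˡ-≡ (lowerDeg x + levelDeg x) _ _ (trans (degrees-sum x) (trans (sym (degrees-sum x′))
        (cong₂ (λ u v → u + v + upperDeg x′) (lowerDeg-CR {x′} {x} refl cwt≡) (levelDeg-CR {x′} {x} refl cwt≡))))

      levelSize-upper≡lower : ∀ {j y₀ y₁} → cwt y₀ ≡ j → cwt y₁ ≡ suc j → levelSize j * upperDeg y₀ ≡ levelSize (suc j) * lowerDeg y₁
      levelSize-upper≡lower {j} {y₀} {y₁} cwt₀ cwt₁ = begin
        levelSize j * upperDeg y₀                              ≡⟨ ∑-level j upperDeg y₀ (λ y cwt≡ → upperDeg-CR (trans cwt≡ (sym cwt₀))) ⟨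
        𝕎.∑ₑ (λ y → 𝟙 (cwt y ℕ.≟ j) * upperDeg y)             ≡⟨ ∑-upperDeg≡∑-lowerDeg j ⟩
        𝕎.∑ₑ (λ y → 𝟙 (cwt y ℕ.≟ suc j) * lowerDeg y)         ≡⟨ ∑-level (suc j) lowerDeg y₁ (λ y cwt≡ → lowerDeg-CR cwt≡ cwt₁) ⟩
        levelSize (suc j) * lowerDeg y₁                        ∎
        where open ≡-Reasoning

      count-upper≡lower : ∀ {j m₀ m₁ y₀ y₁} → Count (SameCoset G) (CosetWeight G j) m₀ → Count (SameCoset G) (CosetWeight G (suc j)) m₁ →
                          cwt y₀ ≡ j → cwt y₁ ≡ suc j → m₀ * upperDeg y₀ ≡ m₁ * lowerDeg y₁
      count-upper≡lower {j} {m₀} {m₁} {y₀} {y₁} count₀ count₁ cwt₀ cwt₁ = *-cancelʳ-≡ _ _ codeSize {{>-nonZero 0<codeSize}} (begin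
        m₀ * upperDeg y₀ * codeSize       ≡⟨ *ℕ.xy∙z≈xz∙y m₀ _ _ ⟩
        m₀ * codeSize * upperDeg y₀       ≡⟨ cong (_* upperDeg y₀) (levelSize-Count count₀) ⟨
        levelSize j * upperDeg y₀         ≡⟨ levelSize-upper≡lower cwt₀ cwt₁ ⟩
        levelSize (suc j) * lowerDeg y₁   ≡⟨ cong (_* lowerDeg y₁) (levelSize-Count count₁) ⟩
        m₁ * codeSize * lowerDeg y₁       ≡⟨ *ℕ.xy∙z≈xz∙y m₁ _ _ ⟩
        m₁ * lowerDeg y₁ * codeSize       ∎)
        where open ≡-Reasoning

      log-concave-at : ∀ {i d₀ d₁ d₂} x → suc (suc i) ≤ cwt x →
        Count (SameCoset G) (CosetWeight G i) d₀ → Count (SameCoset G) (CosetWeight G (suc i)) d₁ →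
        Count (SameCoset G) (CosetWeight G (suc (suc i))) d₂ → d₀ * d₂ ≤ d₁ * d₁
      log-concave-at {d₀ = d₀} {d₁} {d₂} x i+2≤cwt count₀ count₁ count₂ =
        let (x₂ , cwt₂)      = cwt-exists i+2≤cwt
            (p₁ , a₁ , cwt₁) = descend cwt₂
            (p₀ , a₀ , cwt₀) = descend cwt₁
            step₀ = trans (cong suc cwt₀) (sym cwt₁)
            step₁ = trans (cong suc cwt₁) (sym cwt₂)
        in log-concave-step d₀ d₁ d₂ _ _ _ _ (count-upper≡lower count₀ count₁ cwt₀ cwt₁) (count-upper≡lower count₁ count₂ cwt₁ cwt₂)
             (upperDeg-antitone (Adj-addAt _ p₀ a₀) step₀) (lowerDeg-monotone (Adj-addAt x₂ p₁ a₁) step₁)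
             {{>-nonZero (0<lowerDeg _ p₀ a₀ step₀)}} {{>-nonZero (0<lowerDeg x₂ p₁ a₁ step₁)}}

corollary5 : ∀ {c ℓ : Level} {q : ℕ} (F : FiniteField c ℓ q) (k n : ℕ)
    (G : Fin k → Fin n → FiniteField.Carrier F) →
    Code.Projective F G → Code.CompletelyRegular F G →
    (ρ : ℕ) → Code.CoveringRadius F G ρ →
    (d : ℕ → ℕ) →
    (∀ i → i ≤ ρ → Count (Code.SameCoset F G) (Code.CosetWeight F G i) (d i)) →
    LogConcave d ρ
corollary5 F k n G _ cr ρ ((x , x-weight) , _) d count i i+2≤ρ =
  log-concave-at F G cr x (subst (suc (suc i) ≤_) (CosetWeight⇒≡cwt F G x-weight) i+2≤ρ)
                 (count i (≤-trans (n≤1+n i) i+1≤ρ)) (count (suc i) i+1≤ρ) (count (suc (suc i)) i+2≤ρ)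
  where
  i+1≤ρ : suc i ≤ ρ
  i+1≤ρ = ≤-trans (n≤1+n (suc i)) i+2≤ρ
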